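{- Let $p$ be a prime and let $I$ be a function assigning an element $I(\pi)\in\mathbb{Z}/p\mathbb{Z}$ to each finite probability space $(X,\pi)$ mod $p$. The following are equivalent: (i) $I$ is isomorphism-invariant (if $f\colon Y\to X$ is a bijection with $\sigma_y=\pi_{f(y)}$ for all $y$, then $I(\sigma)=I(\pi)$) and satisfies the chain rule $$I\Bigl(\coprod_{x\in X}\pi_x\gamma^x\Bigr)=I(\pi)+\sum_{x\in X}\pi_xI(\gamma^x)$$ for all finite probability spaces $(X,\pi)$ and $(Y_x,\gamma^x)_{x\in X}$ mod $p$; (ii) $I=cH$ for some $c\in\mathbb{Z}/p\mathbb{Z}$.
   Context: A finite probability space mod $p$ is a finite set $X$ with $\pi=(\pi_x)_{x\in X}\in(\mathbb{Z}/p\mathbb{Z})^X$, $\sum_x\pi_x=1$. Its entropy is $H(\pi)=\frac1p(1-\sum_xa_x^p)\in\mathbb{Z}/p\mathbb{Z}$ with $a_x\in\mathbb{Z}$ representing $\pi_x$. Given $(X,\pi)$ and a family $(Y_x,\gamma^x)_{x\in X}$, the convex combination $\bigl(\coprod_xY_x,\coprod_x\pi_x\gamma^x\bigr)$ is the disjoint union of the $Y_x$, with $y\in Y_x$ given probability $\pi_x\gamma^x_y$. -}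

module Defs where

open import Data.Nat as ℕ using (ℕ; zero; suc; NonZero)
open import Data.Nat.DivMod as NDM using ()
open import Data.Fin as F using (Fin; toℕ)
open import Data.Integer as ℤ using (ℤ; +_)
open import Data.Integer.DivMod using (_/ℕ_; _%ℕ_)
open import Data.Vec.Functional using (Vector; _++_)

-- The ring ℤ/pℤ, represented by the canonical residues Fin p = {0,…,p-1}.
module _ (p : ℕ) .{{_ : NonZero p}} where

  Zp : Set
  Zp = Fin p

  ℕ→Zp : ℕ → Zp
  ℕ→Zp n = n NDM.mod p

  ℤ→Zp : ℤ → Zp
  ℤ→Zp z = ℕ→Zp (z %ℕ p)

  0ₚ 1ₚ : Zp
  0ₚ = ℕ→Zp 0
  1ₚ = ℕ→Zp 1

  addₚ mulₚ : Zp → Zp → Zp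
  addₚ a b = ℕ→Zp (toℕ a ℕ.+ toℕ b)
  mulₚ a b = ℕ→Zp (toℕ a ℕ.* toℕ b)

  sumₚ : (n : ℕ) → (Fin n → Zp) → Zp
  sumₚ zero    f = 0ₚ
  sumₚ (suc n) f = addₚ (f F.zero) (sumₚ n (λ x → f (F.suc x)))

  IsProb : (n : ℕ) → (Fin n → Zp) → Set
  IsProb n π = sumₚ n π ≡ 1ₚ
    where open import Relation.Binary.PropositionalEquality using (_≡_)

  -- Entropy  H(π) = (1/p) (1 - Σ_x a_x^p)  with a_x ∈ ℤ the canonical lift of π_x
  -- (the integer 1 - Σ a_x^p is divisible by p when Σ π_x = 1).
  sumℤ : (n : ℕ) → (Fin n → ℤ) → ℤ
  sumℤ zero    f = + 0
  sumℤ (suc n) f = f F.zero ℤ.+ sumℤ n (λ x → f (F.suc x))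

  H : (n : ℕ) → (Fin n → Zp) → Zp
  H n π = ℤ→Zp (((+ 1) ℤ.- sumℤ n (λ x → (+ toℕ (π x)) ℤ.^ p)) /ℕ p)

  -- Disjoint union  ∐_{x ∈ Fin n} Fin (k x)  realised as Fin (Σ_x k x),
  -- listing the blocks Y_0, Y_1, …, Y_{n-1} in order.
  total : (n : ℕ) → (Fin n → ℕ) → ℕ
  total zero    k = 0
  total (suc n) k = k F.zero ℕ.+ total n (λ x → k (F.suc x))

  -- the convex combination ∐_x π_x γ^x : element y of block x gets π_x · γ^x_y
  coprod : (n : ℕ) (π : Fin n → Zp) (k : Fin n → ℕ)
           (γ : (x : Fin n) → Fin (k x) → Zp) → Fin (total n k) → Zp
  coprod zero    π k γ = λ ()
  coprod (suc n) π k γ =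
    (λ y → mulₚ (π F.zero) (γ F.zero y))
      ++ coprod n (λ x → π (F.suc x)) (λ x → k (F.suc x)) (λ x → γ (F.suc x))

{-# OPTIONS --safe #-}
module Submission where

-- (ii) ⇒ (i). For the chain rule write aₓ, bₓᵧ for the canonical integer
-- lifts of πₓ, γˣᵧ. The lift of πₓ γˣᵧ is congruent to aₓ bₓᵧ mod p, so its p-th power is congruent to
-- aₓᵖ bₓᵧᵖ mod p². Summing, 1 - Σₓᵧ (lift of πₓ γˣᵧ)ᵖ ≡ (1 - Σₓ aₓᵖ) + p Σₓ aₓᵖ H(γˣ) (mod p²); divide
-- by p and use aₓᵖ ≡ πₓ (Fermat).
--
-- (i) ⇒ (ii). Both axioms are preserved by linear combinations, and H = -1 on the all-ones vector of
-- length p + 1, so J = I - c H with c = -I(1,…,1) satisfies them and vanishes on that vector. The chain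
-- rule then forces J = 0: on a point and on (0,1), hence on the all-ones vectors of length 1 + mp and,
-- dropping zeros, on all 0/1-vectors. On the uniform vector u_A (p ∤ A), J(u_AB) = J(u_A) + J(u_B), so
-- (p - 1) J(u_A) = J(u_{A^(p-1)}) = 0. Finally, refining each point of mass a ≠ 0 into u_a turns any π
-- into a 0/1-vector, and the chain rule gives J(π) = 0.

open import Defs
open import Data.Nat using (ℕ; NonZero)
open import Data.Nat.Primality using (Prime)
open import Data.Fin using (Fin)
open import Data.Product using (Σ; _×_)
open import Function.Definitions using (Bijective)
open import Function.Bundles using (_⇔_)
open import Relation.Binary.PropositionalEquality using (_≡_)

open import Algebra.Bundles using (CommutativeRing; CommutativeSemiring)
open import Algebra.Structures using (IsCommutativeRing)
import Algebra.Solver.Ring.AlmostCommutativeRing as ACR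
open import Data.Empty using (⊥-elim)
open import Data.Fin as F using (toℕ; zero; suc)
import Data.Fin.Properties as F
open import Data.Fin.Permutation using (Permutation; permutation; _⟨$⟩ʳ_; transpose)
open import Data.Integer as ℤ using (ℤ; +_; -[1+_])
import Data.Integer.Properties as ℤ
open import Data.Integer.DivMod using (_/ℕ_; _%ℕ_; a≡a%ℕn+[a/ℕn]*n; n%ℕd<d)
open import Data.Integer.Tactic.RingSolver using (solve-∀)
open import Data.Maybe using (Maybe; just; nothing)
import Data.Nat as ℕ
open import Data.Nat using (zero; suc; _!; s≤s; z≤n)
import Data.Nat.Properties as ℕ
import Data.Nat.DivMod as ℕ
open import Data.Nat.Combinatorics using (_C_; nCn≡1)
open import Data.Nat.Combinatorics.Specification using (nCk≡n!/k![n-k]!; [n∸k]!k!∣n!)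
open import Data.Nat.Divisibility using (_∣_; divides; m%n≡0⇒n∣m; ∣⇒≤; m∣m*n)
open import Data.Nat.Primality using (euclidsLemma)
open import Data.Product using (_,_; proj₁; proj₂)
open import Data.Sum as Sum using (_⊎_; inj₁; inj₂)
open import Data.Vec.Functional using (_++_)
open import Function using (id; _∘_; mk⤖)
open import Function.Bundles using (Bijection; mk⇔)
import Function.Construct.Identity as Identity
open import Function.Properties.Bijection using (⤖⇒↔)
open import Function.Properties.Inverse using (↔⇒⤖)
open import Relation.Binary.PropositionalEquality
  using (_≢_; _≗_; refl; sym; trans; cong; cong₂; subst; isEquivalence; module ≡-Reasoning)
open import Relation.Nullary using (¬_; Dec; yes; no)

module _ {a} {A : Set a} where

  ++-suc : ∀ {m n} (f : Fin (suc m) → A) (g : Fin n → A) → (f ++ g) ∘ suc ≗ (f ∘ suc) ++ g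
  ++-suc {m} f g i with F.splitAt m i
  ... | inj₁ _ = refl
  ... | inj₂ _ = refl

  ++-[] : ∀ {n} (f : Fin n → A) (g : Fin 0 → A) → f ++ g ≗ f ∘ F.cast (ℕ.+-identityʳ n)
  ++-[] {suc n} f g zero    = refl
  ++-[] {suc n} f g (suc i) = trans (++-suc f g i) (++-[] (f ∘ suc) g i)

  map-++ : ∀ {b} {B : Set b} {m n} (h : A → B) (f : Fin m → A) (g : Fin n → A) → h ∘ (f ++ g) ≗ (h ∘ f) ++ (h ∘ g)
  map-++ {m = m} h f g i with F.splitAt m i
  ... | inj₁ _ = refl
  ... | inj₂ _ = refl


permutation-bijective : ∀ {m n} (σ : Permutation m n) → Bijective _≡_ _≡_ (σ ⟨$⟩ʳ_)
permutation-bijective σ = Bijection.bijective (↔⇒⤖ σ)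

cast-bijective : ∀ {m n} (eq : m ≡ n) → Bijective _≡_ _≡_ (F.cast eq)
cast-bijective eq = permutation-bijective
  (permutation (F.cast eq) (F.cast (sym eq)) (F.cast-involutive eq (sym eq)) (F.cast-involutive (sym eq) eq))

ℤ-^-distrib-* : ∀ x y n → (x ℤ.* y) ℤ.^ n ≡ x ℤ.^ n ℤ.* y ℤ.^ n
ℤ-^-distrib-* x y zero    = refl
ℤ-^-distrib-* x y (suc n) = trans (cong (ℤ._*_ (x ℤ.* y)) (ℤ-^-distrib-* x y n)) (interchange x y (x ℤ.^ n) (y ℤ.^ n))
  where
  interchange : ∀ a b c d → (a ℤ.* b) ℤ.* (c ℤ.* d) ≡ (a ℤ.* c) ℤ.* (b ℤ.* d)
  interchange = solve-∀

geometric : ℕ → ℤ → ℤ → ℤ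
geometric zero    x y = + 0
geometric (suc n) x y = x ℤ.^ n ℤ.+ y ℤ.* geometric n x y

x^n-y^n≡[x-y]*geometric : ∀ n x y → x ℤ.^ n ℤ.- y ℤ.^ n ≡ (x ℤ.- y) ℤ.* geometric n x y
x^n-y^n≡[x-y]*geometric zero    x y = trans (ℤ.+-inverseʳ (+ 1)) (sym (ℤ.*-zeroʳ (x ℤ.- y)))
x^n-y^n≡[x-y]*geometric (suc n) x y = begin
  x ℤ.* x ℤ.^ n ℤ.- y ℤ.* y ℤ.^ n                               ≡⟨ split x y (x ℤ.^ n) (y ℤ.^ n) ⟩
  (x ℤ.- y) ℤ.* x ℤ.^ n ℤ.+ y ℤ.* (x ℤ.^ n ℤ.- y ℤ.^ n)         ≡⟨ cong (λ t → (x ℤ.- y) ℤ.* x ℤ.^ n ℤ.+ y ℤ.* t)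
                                                                     (x^n-y^n≡[x-y]*geometric n x y) ⟩
  (x ℤ.- y) ℤ.* x ℤ.^ n ℤ.+ y ℤ.* ((x ℤ.- y) ℤ.* geometric n x y) ≡⟨ factor x y (x ℤ.^ n) (geometric n x y) ⟩
  (x ℤ.- y) ℤ.* geometric (suc n) x y                            ∎
  where
  open ≡-Reasoning
  split : ∀ x y a b → x ℤ.* a ℤ.- y ℤ.* b ≡ (x ℤ.- y) ℤ.* a ℤ.+ y ℤ.* (a ℤ.- b)
  split = solve-∀
  factor : ∀ x y a g → (x ℤ.- y) ℤ.* a ℤ.+ y ℤ.* ((x ℤ.- y) ℤ.* g) ≡ (x ℤ.- y) ℤ.* (a ℤ.+ y ℤ.* g)
  factor = solve-∀

-- sumₚ and sumℤ are recursive copies of the library's sum; this transfers its lemmas to them.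
module RecursiveSum {c ℓ} (R : CommutativeSemiring c ℓ)
  (∑ : (n : ℕ) → (Fin n → CommutativeSemiring.Carrier R) → CommutativeSemiring.Carrier R)
  (∑-zero : ∀ f → ∑ 0 f ≡ CommutativeSemiring.0# R)
  (∑-suc : ∀ n f → ∑ (suc n) f ≡ CommutativeSemiring._+_ R (f zero) (∑ n (f ∘ suc)))
  where

  open CommutativeSemiring R hiding (refl; sym; trans; zero)
  open import Algebra.Properties.Semiring.Sum semiring
    using (sum; sum-cong-≗; *-distribˡ-sum; *-distribʳ-sum; sum-permute)
  import Algebra.Properties.Semiring.Sum semiring as SemiringSum
  open import Relation.Binary.Reasoning.Setoid setoid

  ∑≡sum : ∀ n f → ∑ n f ≡ sum f
  ∑≡sum zero    f = ∑-zero f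
  ∑≡sum (suc n) f = trans (∑-suc n f) (cong (_+_ (f zero)) (∑≡sum n (f ∘ suc)))

  ∑-cong : ∀ n {f g} → f ≗ g → ∑ n f ≡ ∑ n g
  ∑-cong n {f} {g} f≗g = trans (∑≡sum n f) (trans (sum-cong-≗ f≗g) (sym (∑≡sum n g)))

  ∑-distrib-+ : ∀ n f g → ∑ n (λ i → f i + g i) ≈ ∑ n f + ∑ n g
  ∑-distrib-+ n f g = begin
    ∑ n (λ i → f i + g i) ≡⟨ ∑≡sum n _ ⟩
    sum (λ i → f i + g i) ≈⟨ SemiringSum.∑-distrib-+ f g ⟩
    sum f + sum g         ≡⟨ cong₂ _+_ (∑≡sum n f) (∑≡sum n g) ⟨
    ∑ n f + ∑ n g         ∎

  *-distribˡ-∑ : ∀ n x f → x * ∑ n f ≈ ∑ n (λ i → x * f i)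
  *-distribˡ-∑ n x f = begin
    x * ∑ n f              ≡⟨ cong (_*_ x) (∑≡sum n f) ⟩
    x * sum f              ≈⟨ *-distribˡ-sum x f ⟩
    sum (λ i → x * f i)    ≡⟨ ∑≡sum n _ ⟨
    ∑ n (λ i → x * f i)    ∎

  *-distribʳ-∑ : ∀ n x f → ∑ n f * x ≈ ∑ n (λ i → f i * x)
  *-distribʳ-∑ n x f = begin
    ∑ n f * x              ≡⟨ cong (_* x) (∑≡sum n f) ⟩
    sum f * x              ≈⟨ *-distribʳ-sum x f ⟩
    sum (λ i → f i * x)    ≡⟨ ∑≡sum n _ ⟨
    ∑ n (λ i → f i * x)    ∎

  ∑-reindex : ∀ m n (f : Fin m → Fin n) → Bijective _≡_ _≡_ f → ∀ g → ∑ m (g ∘ f) ≈ ∑ n g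
  ∑-reindex m n f f-bij g = begin
    ∑ m (g ∘ f) ≡⟨ ∑≡sum m (g ∘ f) ⟩
    sum (g ∘ f) ≈⟨ sum-permute g (⤖⇒↔ (mk⤖ f-bij)) ⟨
    sum g       ≡⟨ ∑≡sum n g ⟨
    ∑ n g       ∎

  ∑-++ : ∀ m n (f : Fin m → Carrier) (g : Fin n → Carrier) → ∑ (m ℕ.+ n) (f ++ g) ≈ ∑ m f + ∑ n g
  ∑-++ zero n f g = begin
    ∑ n g          ≈⟨ +-identityˡ (∑ n g) ⟨
    0# + ∑ n g     ≡⟨ cong (_+ ∑ n g) (∑-zero f) ⟨
    ∑ 0 f + ∑ n g  ∎
  ∑-++ (suc m) n f g = begin
    ∑ (suc (m ℕ.+ n)) (f ++ g)             ≡⟨ ∑-suc (m ℕ.+ n) (f ++ g) ⟩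
    f zero + ∑ (m ℕ.+ n) ((f ++ g) ∘ suc)  ≡⟨ cong (_+_ (f zero)) (∑-cong (m ℕ.+ n) (++-suc f g)) ⟩
    f zero + ∑ (m ℕ.+ n) ((f ∘ suc) ++ g)  ≈⟨ +-congˡ (∑-++ m n (f ∘ suc) g) ⟩
    f zero + (∑ m (f ∘ suc) + ∑ n g)       ≈⟨ +-assoc _ _ _ ⟨
    (f zero + ∑ m (f ∘ suc)) + ∑ n g       ≡⟨ cong (_+ ∑ n g) (∑-suc m f) ⟨
    ∑ (suc m) f + ∑ n g                    ∎

  ∑-coprod : ∀ p .{{_ : NonZero p}} n π k γ (G : Zp p → Carrier) →
    ∑ (total p n k) (G ∘ coprod p n π k γ) ≈ ∑ n (λ x → ∑ (k x) (λ y → G (mulₚ p (π x) (γ x y))))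
  ∑-coprod p zero π k γ G = reflexive (trans (∑-zero _) (sym (∑-zero _)))
  ∑-coprod p (suc n) π k γ G = begin
    ∑ (k zero ℕ.+ total p n (k ∘ suc)) (G ∘ coprod p (suc n) π k γ)
      ≡⟨ ∑-cong _ (map-++ {m = k zero} G block (coprod p n (π ∘ suc) (k ∘ suc) (γ ∘ suc))) ⟩
    ∑ (k zero ℕ.+ total p n (k ∘ suc)) ((G ∘ block) ++ (G ∘ coprod p n (π ∘ suc) (k ∘ suc) (γ ∘ suc)))
      ≈⟨ ∑-++ (k zero) (total p n (k ∘ suc)) _ _ ⟩
    ∑ (k zero) (G ∘ block) + ∑ (total p n (k ∘ suc)) (G ∘ coprod p n (π ∘ suc) (k ∘ suc) (γ ∘ suc))
      ≈⟨ +-congˡ (∑-coprod p n (π ∘ suc) (k ∘ suc) (γ ∘ suc) G) ⟩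
    ∑ (k zero) (G ∘ block) + ∑ n (λ x → ∑ (k (suc x)) (λ y → G (mulₚ p (π (suc x)) (γ (suc x) y))))
      ≡⟨ ∑-suc n _ ⟨
    ∑ (suc n) (λ x → ∑ (k x) (λ y → G (mulₚ p (π x) (γ x y)))) ∎
    where
    block = λ y → mulₚ p (π zero) (γ zero y)

module Residues (p : ℕ) .{{_ : NonZero p}} where

  ι : ℕ → Zp p
  ι = ℕ→Zp p

  φ : ℤ → Zp p
  φ = ℤ→Zp p

  infixl 6 _+ₚ_ _-ₚ_
  infixl 7 _*ₚ_

  _+ₚ_ _*ₚ_ : Zp p → Zp p → Zp p
  _+ₚ_ = addₚ p
  _*ₚ_ = mulₚ p

  -ₚ_ : Zp p → Zp p
  -ₚ a = ι (p ℕ.∸ toℕ a)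

  _-ₚ_ : Zp p → Zp p → Zp p
  a -ₚ b = a +ₚ (-ₚ b)

  0# 1# : Zp p
  0# = ι 0
  1# = ι 1

  toℕ-ι : ∀ n → toℕ (ι n) ≡ n ℕ.% p
  toℕ-ι n = F.toℕ-fromℕ< (ℕ.m%n<n n p)

  toℕ-0# : toℕ 0# ≡ 0
  toℕ-0# = trans (toℕ-ι 0) (ℕ.m*n%n≡0 0 p)

  ι-toℕ : ∀ a → ι (toℕ a) ≡ a
  ι-toℕ a = F.toℕ-injective (trans (toℕ-ι (toℕ a)) (ℕ.m<n⇒m%n≡m (F.toℕ<n a)))

  ι-cong-% : ∀ m n → m ℕ.% p ≡ n ℕ.% p → ι m ≡ ι n
  ι-cong-% m n eq = F.toℕ-injective (trans (toℕ-ι m) (trans eq (sym (toℕ-ι n))))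

  ι-+ : ∀ m n → ι (m ℕ.+ n) ≡ ι m +ₚ ι n
  ι-+ m n = ι-cong-% _ _ (trans (ℕ.%-distribˡ-+ m n p)
    (cong₂ (λ a b → (a ℕ.+ b) ℕ.% p) (sym (toℕ-ι m)) (sym (toℕ-ι n))))

  ι-* : ∀ m n → ι (m ℕ.* n) ≡ ι m *ₚ ι n
  ι-* m n = ι-cong-% _ _ (trans (ℕ.%-distribˡ-* m n p)
    (cong₂ (λ a b → (a ℕ.* b) ℕ.% p) (sym (toℕ-ι m)) (sym (toℕ-ι n))))

  ι-multiple : ∀ m → p ∣ m → ι m ≡ 0#
  ι-multiple m (divides d refl) = ι-cong-% _ 0 (trans (ℕ.m*n%n≡0 d p) (sym (ℕ.m*n%n≡0 0 p)))

  ι≡0⇒∣ : ∀ m → ι m ≡ 0# → p ∣ m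
  ι≡0⇒∣ m eq = m%n≡0⇒n∣m m p (trans (sym (toℕ-ι m)) (trans (cong toℕ eq) toℕ-0#))

  ι-p : ι p ≡ 0#
  ι-p = ι-multiple p (divides 1 (sym (ℕ.*-identityˡ p)))

  ι-elim : ∀ {P : Zp p → Set} → (∀ n → P (ι n)) → ∀ a → P a
  ι-elim {P} h a = subst P (ι-toℕ a) (h (toℕ a))

  +-comm : ∀ a b → a +ₚ b ≡ b +ₚ a
  +-comm a b = cong ι (ℕ.+-comm (toℕ a) (toℕ b))

  *-comm : ∀ a b → a *ₚ b ≡ b *ₚ a
  *-comm a b = cong ι (ℕ.*-comm (toℕ a) (toℕ b))

  +-assoc : ∀ a b c → (a +ₚ b) +ₚ c ≡ a +ₚ (b +ₚ c)
  +-assoc = ι-elim λ x → ι-elim λ y → ι-elim λ z → begin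
    (ι x +ₚ ι y) +ₚ ι z ≡⟨ cong (_+ₚ ι z) (ι-+ x y) ⟨
    ι (x ℕ.+ y) +ₚ ι z  ≡⟨ ι-+ (x ℕ.+ y) z ⟨
    ι (x ℕ.+ y ℕ.+ z)   ≡⟨ cong ι (ℕ.+-assoc x y z) ⟩
    ι (x ℕ.+ (y ℕ.+ z)) ≡⟨ ι-+ x (y ℕ.+ z) ⟩
    ι x +ₚ ι (y ℕ.+ z)  ≡⟨ cong (ι x +ₚ_) (ι-+ y z) ⟩
    ι x +ₚ (ι y +ₚ ι z) ∎
    where open ≡-Reasoning

  *-assoc : ∀ a b c → (a *ₚ b) *ₚ c ≡ a *ₚ (b *ₚ c)
  *-assoc = ι-elim λ x → ι-elim λ y → ι-elim λ z → begin
    (ι x *ₚ ι y) *ₚ ι z ≡⟨ cong (_*ₚ ι z) (ι-* x y) ⟨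
    ι (x ℕ.* y) *ₚ ι z  ≡⟨ ι-* (x ℕ.* y) z ⟨
    ι (x ℕ.* y ℕ.* z)   ≡⟨ cong ι (ℕ.*-assoc x y z) ⟩
    ι (x ℕ.* (y ℕ.* z)) ≡⟨ ι-* x (y ℕ.* z) ⟩
    ι x *ₚ ι (y ℕ.* z)  ≡⟨ cong (ι x *ₚ_) (ι-* y z) ⟩
    ι x *ₚ (ι y *ₚ ι z) ∎
    where open ≡-Reasoning

  *-distribʳ-+ : ∀ a b c → (b +ₚ c) *ₚ a ≡ b *ₚ a +ₚ c *ₚ a
  *-distribʳ-+ = ι-elim λ x → ι-elim λ y → ι-elim λ z → begin
    (ι y +ₚ ι z) *ₚ ι x        ≡⟨ cong (_*ₚ ι x) (ι-+ y z) ⟨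
    ι (y ℕ.+ z) *ₚ ι x         ≡⟨ ι-* (y ℕ.+ z) x ⟨
    ι ((y ℕ.+ z) ℕ.* x)        ≡⟨ cong ι (ℕ.*-distribʳ-+ x y z) ⟩
    ι (y ℕ.* x ℕ.+ z ℕ.* x)    ≡⟨ ι-+ (y ℕ.* x) (z ℕ.* x) ⟩
    ι (y ℕ.* x) +ₚ ι (z ℕ.* x) ≡⟨ cong₂ _+ₚ_ (ι-* y x) (ι-* z x) ⟩
    ι y *ₚ ι x +ₚ ι z *ₚ ι x   ∎
    where open ≡-Reasoning

  *-distribˡ-+ : ∀ a b c → a *ₚ (b +ₚ c) ≡ a *ₚ b +ₚ a *ₚ c
  *-distribˡ-+ a b c = trans (*-comm a _)
    (trans (*-distribʳ-+ a b c) (cong₂ _+ₚ_ (*-comm b a) (*-comm c a)))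

  +-identityˡ : ∀ a → 0# +ₚ a ≡ a
  +-identityˡ = ι-elim λ x → sym (ι-+ 0 x)

  +-identityʳ : ∀ a → a +ₚ 0# ≡ a
  +-identityʳ a = trans (+-comm a 0#) (+-identityˡ a)

  *-identityˡ : ∀ a → 1# *ₚ a ≡ a
  *-identityˡ = ι-elim λ x → trans (sym (ι-* 1 x)) (cong ι (ℕ.*-identityˡ x))

  *-identityʳ : ∀ a → a *ₚ 1# ≡ a
  *-identityʳ a = trans (*-comm a 1#) (*-identityˡ a)

  *-zeroˡ : ∀ a → 0# *ₚ a ≡ 0#
  *-zeroˡ = ι-elim λ x → sym (ι-* 0 x)

  *-zeroʳ : ∀ a → a *ₚ 0# ≡ 0#
  *-zeroʳ a = trans (*-comm a 0#) (*-zeroˡ a)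

  ι-suc-* : ∀ n a → ι (suc n) *ₚ a ≡ a +ₚ ι n *ₚ a
  ι-suc-* n a = begin
    ι (suc n) *ₚ a       ≡⟨ cong (_*ₚ a) (ι-+ 1 n) ⟩
    (1# +ₚ ι n) *ₚ a     ≡⟨ *-distribʳ-+ a 1# (ι n) ⟩
    1# *ₚ a +ₚ ι n *ₚ a  ≡⟨ cong (_+ₚ ι n *ₚ a) (*-identityˡ a) ⟩
    a +ₚ ι n *ₚ a        ∎
    where open ≡-Reasoning

  -‿inverseˡ : ∀ a → (-ₚ a) +ₚ a ≡ 0#
  -‿inverseˡ a = begin
    ι (p ℕ.∸ toℕ a) +ₚ a          ≡⟨ cong (ι (p ℕ.∸ toℕ a) +ₚ_) (ι-toℕ a) ⟨
    ι (p ℕ.∸ toℕ a) +ₚ ι (toℕ a)  ≡⟨ ι-+ (p ℕ.∸ toℕ a) (toℕ a) ⟨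
    ι (p ℕ.∸ toℕ a ℕ.+ toℕ a)     ≡⟨ cong ι (ℕ.m∸n+n≡m (ℕ.<⇒≤ (F.toℕ<n a))) ⟩
    ι p                           ≡⟨ ι-p ⟩
    0#                            ∎
    where open ≡-Reasoning

  -‿inverseʳ : ∀ a → a +ₚ (-ₚ a) ≡ 0#
  -‿inverseʳ a = trans (+-comm a _) (-‿inverseˡ a)

  ι[1+p]≡1 : ι (suc p) ≡ 1#
  ι[1+p]≡1 = trans (ι-+ 1 p) (trans (cong (1# +ₚ_) ι-p) (+-identityʳ 1#))

  +-*-isCommutativeRing : IsCommutativeRing _≡_ _+ₚ_ _*ₚ_ -ₚ_ 0# 1#
  +-*-isCommutativeRing = record
    { isRing = record
      { +-isAbelianGroup = record
        { isGroup = record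
          { isMonoid = record
            { isSemigroup = record
              { isMagma = record { isEquivalence = isEquivalence ; ∙-cong = cong₂ _+ₚ_ }
              ; assoc = +-assoc }
            ; identity = +-identityˡ , +-identityʳ }
          ; inverse = -‿inverseˡ , -‿inverseʳ
          ; ⁻¹-cong = cong (λ a → -ₚ a) }
        ; comm = +-comm }
      ; *-cong = cong₂ _*ₚ_
      ; *-assoc = *-assoc
      ; *-identity = *-identityˡ , *-identityʳ
      ; distrib = *-distribˡ-+ , *-distribʳ-+ }
    ; *-comm = *-comm }

  +-*-commutativeRing : CommutativeRing _ _
  +-*-commutativeRing = record { isCommutativeRing = +-*-isCommutativeRing }

  [r+kp≡s]⇒r%p≡s%p : ∀ r s k → + r ℤ.+ k ℤ.* + p ≡ + s → r ℕ.% p ≡ s ℕ.% p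
  [r+kp≡s]⇒r%p≡s%p r s (+ j) eq = begin
    r ℕ.% p                 ≡⟨ ℕ.[m+kn]%n≡m%n r j p ⟨
    (r ℕ.+ j ℕ.* p) ℕ.% p   ≡⟨ cong (ℕ._% p) (ℤ.+-injective eq′) ⟩
    s ℕ.% p                 ∎
    where
    open ≡-Reasoning
    eq′ : + (r ℕ.+ j ℕ.* p) ≡ + s
    eq′ = trans (trans (ℤ.pos-+ r (j ℕ.* p)) (cong (ℤ._+_ (+ r)) (ℤ.pos-* j p))) eq
  [r+kp≡s]⇒r%p≡s%p r s -[1+ j ] eq = sym (begin
    s ℕ.% p                     ≡⟨ ℕ.[m+kn]%n≡m%n s (suc j) p ⟨
    (s ℕ.+ suc j ℕ.* p) ℕ.% p ≡⟨ cong (ℕ._% p) (ℤ.+-injective eq′) ⟩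
    r ℕ.% p                     ∎)
    where
    open ≡-Reasoning
    cancel : ∀ a b c → (a ℤ.+ ℤ.- c ℤ.* b) ℤ.+ c ℤ.* b ≡ a
    cancel = solve-∀
    eq′ : + (s ℕ.+ suc j ℕ.* p) ≡ + r
    eq′ = begin
      + (s ℕ.+ suc j ℕ.* p)                        ≡⟨ ℤ.pos-+ s (suc j ℕ.* p) ⟩
      + s ℤ.+ + (suc j ℕ.* p)                      ≡⟨ cong (ℤ._+_ (+ s)) (ℤ.pos-* (suc j) p) ⟩
      + s ℤ.+ + suc j ℤ.* + p                      ≡⟨ cong (ℤ._+ + suc j ℤ.* + p) eq ⟨
      (+ r ℤ.+ -[1+ j ] ℤ.* + p) ℤ.+ + suc j ℤ.* + p ≡⟨ cancel (+ r) (+ p) (+ suc j) ⟩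
      + r                                            ∎

  φ-r+kp : ∀ x r k → x ≡ + r ℤ.+ k ℤ.* + p → φ x ≡ ι r
  φ-r+kp x r k eq = ι-cong-% (x %ℕ p) r (sym ([r+kp≡s]⇒r%p≡s%p r (x %ℕ p) (k ℤ.- x /ℕ p) eq′))
    where
    open ≡-Reasoning
    shift : ∀ a b c d → a ℤ.+ (b ℤ.- c) ℤ.* d ≡ (a ℤ.+ b ℤ.* d) ℤ.- c ℤ.* d
    shift = solve-∀
    cancel : ∀ a b c → (a ℤ.+ b ℤ.* c) ℤ.- b ℤ.* c ≡ a
    cancel = solve-∀
    eq′ : + r ℤ.+ (k ℤ.- x /ℕ p) ℤ.* + p ≡ + (x %ℕ p)
    eq′ = begin
      + r ℤ.+ (k ℤ.- x /ℕ p) ℤ.* + p                           ≡⟨ shift (+ r) k (x /ℕ p) (+ p) ⟩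
      (+ r ℤ.+ k ℤ.* + p) ℤ.- x /ℕ p ℤ.* + p                   ≡⟨ cong (ℤ._- x /ℕ p ℤ.* + p) eq ⟨
      x ℤ.- x /ℕ p ℤ.* + p                                     ≡⟨ cong (ℤ._- x /ℕ p ℤ.* + p) (a≡a%ℕn+[a/ℕn]*n x p) ⟩
      (+ (x %ℕ p) ℤ.+ x /ℕ p ℤ.* + p) ℤ.- x /ℕ p ℤ.* + p       ≡⟨ cancel (+ (x %ℕ p)) (x /ℕ p) (+ p) ⟩
      + (x %ℕ p)                                               ∎

  φ-pos : ∀ n → φ (+ n) ≡ ι n
  φ-pos n = ι-cong-% (n ℕ.% p) n (ℕ.m%n%n≡m%n n p)

  φ-+ : ∀ x y → φ (x ℤ.+ y) ≡ φ x +ₚ φ y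
  φ-+ x y = trans (φ-r+kp (x ℤ.+ y) (a ℕ.+ b) (qx ℤ.+ qy) eq) (ι-+ a b)
    where
    open ≡-Reasoning
    a = x %ℕ p
    b = y %ℕ p
    qx = x /ℕ p
    qy = y /ℕ p
    regroup : ∀ a b c d e → (a ℤ.+ c ℤ.* e) ℤ.+ (b ℤ.+ d ℤ.* e) ≡ (a ℤ.+ b) ℤ.+ (c ℤ.+ d) ℤ.* e
    regroup = solve-∀
    eq : x ℤ.+ y ≡ + (a ℕ.+ b) ℤ.+ (qx ℤ.+ qy) ℤ.* + p
    eq = begin
      x ℤ.+ y                                       ≡⟨ cong₂ ℤ._+_ (a≡a%ℕn+[a/ℕn]*n x p) (a≡a%ℕn+[a/ℕn]*n y p) ⟩
      (+ a ℤ.+ qx ℤ.* + p) ℤ.+ (+ b ℤ.+ qy ℤ.* + p) ≡⟨ regroup (+ a) (+ b) qx qy (+ p) ⟩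
      (+ a ℤ.+ + b) ℤ.+ (qx ℤ.+ qy) ℤ.* + p         ≡⟨ cong (ℤ._+ (qx ℤ.+ qy) ℤ.* + p) (ℤ.pos-+ a b) ⟨
      + (a ℕ.+ b) ℤ.+ (qx ℤ.+ qy) ℤ.* + p           ∎

  φ-* : ∀ x y → φ (x ℤ.* y) ≡ φ x *ₚ φ y
  φ-* x y = trans (φ-r+kp (x ℤ.* y) (a ℕ.* b) k eq) (ι-* a b)
    where
    open ≡-Reasoning
    a = x %ℕ p
    b = y %ℕ p
    qx = x /ℕ p
    qy = y /ℕ p
    k = + a ℤ.* qy ℤ.+ qx ℤ.* + b ℤ.+ qx ℤ.* qy ℤ.* + p
    expand : ∀ a b c d e →
      (a ℤ.+ c ℤ.* e) ℤ.* (b ℤ.+ d ℤ.* e) ≡ a ℤ.* b ℤ.+ (a ℤ.* d ℤ.+ c ℤ.* b ℤ.+ c ℤ.* d ℤ.* e) ℤ.* e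
    expand = solve-∀
    eq : x ℤ.* y ≡ + (a ℕ.* b) ℤ.+ k ℤ.* + p
    eq = begin
      x ℤ.* y                                       ≡⟨ cong₂ ℤ._*_ (a≡a%ℕn+[a/ℕn]*n x p) (a≡a%ℕn+[a/ℕn]*n y p) ⟩
      (+ a ℤ.+ qx ℤ.* + p) ℤ.* (+ b ℤ.+ qy ℤ.* + p) ≡⟨ expand (+ a) (+ b) qx qy (+ p) ⟩
      + a ℤ.* + b ℤ.+ k ℤ.* + p                     ≡⟨ cong (ℤ._+ k ℤ.* + p) (ℤ.pos-* a b) ⟨
      + (a ℕ.* b) ℤ.+ k ℤ.* + p                     ∎

  φ-neg : ∀ x → φ (ℤ.- x) ≡ -ₚ φ x
  φ-neg x = trans (φ-r+kp (ℤ.- x) (p ℕ.∸ a) (ℤ.- qx ℤ.- + 1) eq)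
                  (cong (λ t → ι (p ℕ.∸ t)) (sym (trans (toℕ-ι a) (ℕ.m<n⇒m%n≡m (n%ℕd<d x p)))))
    where
    open ≡-Reasoning
    a = x %ℕ p
    qx = x /ℕ p
    negate : ∀ a b c → ℤ.- (a ℤ.+ b ℤ.* c) ≡ (c ℤ.- a) ℤ.+ (ℤ.- b ℤ.- + 1) ℤ.* c
    negate = solve-∀
    eq : ℤ.- x ≡ + (p ℕ.∸ a) ℤ.+ (ℤ.- qx ℤ.- + 1) ℤ.* + p
    eq = begin
      ℤ.- x                                       ≡⟨ cong ℤ.-_ (a≡a%ℕn+[a/ℕn]*n x p) ⟩
      ℤ.- (+ a ℤ.+ qx ℤ.* + p)                    ≡⟨ negate (+ a) qx (+ p) ⟩
      (+ p ℤ.- + a) ℤ.+ (ℤ.- qx ℤ.- + 1) ℤ.* + p  ≡⟨ cong (ℤ._+ (ℤ.- qx ℤ.- + 1) ℤ.* + p)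
                                                      (trans (ℤ.m-n≡m⊖n p a) (ℤ.⊖-≥ (ℕ.<⇒≤ (n%ℕd<d x p)))) ⟩
      + (p ℕ.∸ a) ℤ.+ (ℤ.- qx ℤ.- + 1) ℤ.* + p    ∎

  φ-morphism : ℤ.+-*-rawRing ACR.-Raw-AlmostCommutative⟶ ACR.fromCommutativeRing +-*-commutativeRing
  φ-morphism = record
    { ⟦_⟧ = φ ; +-homo = φ-+ ; *-homo = φ-* ; -‿homo = φ-neg
    ; 0-homo = φ-pos 0 ; 1-homo = φ-pos 1 }

  φ-≟ : ∀ x y → Maybe (φ x ≡ φ y)
  φ-≟ x y with x ℤ.≟ y
  ... | yes x≡y = just (cong φ x≡y)
  ... | no _    = nothing

  open import Algebra.Solver.Ring ℤ.+-*-rawRing (ACR.fromCommutativeRing +-*-commutativeRing) φ-morphism φ-≟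
    public using (solve; _:=_; _:+_; _:*_; :-_; _:-_; con)

  module ∑ₚ = RecursiveSum (CommutativeRing.commutativeSemiring +-*-commutativeRing) (sumₚ p) (λ _ → refl) (λ _ _ → refl)
  module ∑ℤ = RecursiveSum ℤ.+-*-commutativeSemiring (sumℤ p) (λ _ → refl) (λ _ _ → refl)

  sumℤ-ones : ∀ n → sumℤ p n (λ _ → + 1) ≡ + n
  sumℤ-ones zero    = refl
  sumℤ-ones (suc n) = trans (cong (ℤ._+_ (+ 1)) (sumℤ-ones n)) (sym (ℤ.pos-+ 1 n))

  sumₚ-const : ∀ n a → sumₚ p n (λ _ → a) ≡ ι n *ₚ a
  sumₚ-const zero    a = sym (*-zeroˡ a)
  sumₚ-const (suc n) a = trans (cong (a +ₚ_) (sumₚ-const n a)) (sym (ι-suc-* n a))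

  IsProb-ones : ∀ N → ι N ≡ 1# → IsProb p N (λ _ → 1#)
  IsProb-ones N ιN≡1 = trans (sumₚ-const N 1#) (trans (*-identityʳ (ι N)) ιN≡1)

  sumₚ-zero : ∀ n (f : Fin n → Zp p) → (∀ i → f i ≡ 0#) → sumₚ p n f ≡ 0#
  sumₚ-zero n f f≗0 = trans (∑ₚ.∑-cong n f≗0) (trans (sumₚ-const n 0#) (*-zeroʳ (ι n)))

  ∑ℤ-sub : ∀ m f g → sumℤ p m (λ i → f i ℤ.- g i) ≡ sumℤ p m f ℤ.- sumℤ p m g
  ∑ℤ-sub m f g = trans (∑ℤ.∑-distrib-+ m f (ℤ.-_ ∘ g)) (cong (ℤ._+_ (sumℤ p m f)) ∑-neg)
    where
    ∑-neg : sumℤ p m (ℤ.-_ ∘ g) ≡ ℤ.- sumℤ p m g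
    ∑-neg = trans (∑ℤ.∑-cong m (λ i → sym (ℤ.-1*i≡-i (g i))))
                  (trans (sym (∑ℤ.*-distribˡ-∑ m (ℤ.- + 1) g)) (ℤ.-1*i≡-i _))

module _ (p : ℕ) .{{_ : NonZero p}} where

  open Residues p

  Information : Set
  Information = (n : ℕ) → (Fin n → Zp p) → Zp p

  IsoInvariant : Information → Set
  IsoInvariant I = (m n : ℕ) (f : Fin m → Fin n) → Bijective _≡_ _≡_ f →
    (σ : Fin m → Zp p) (π : Fin n → Zp p) →
    IsProb p m σ → IsProb p n π → ((y : Fin m) → σ y ≡ π (f y)) →
    I m σ ≡ I n π

  ChainRule : Information → Set
  ChainRule I = (n : ℕ) (π : Fin n → Zp p) (k : Fin n → ℕ)
    (γ : (x : Fin n) → Fin (k x) → Zp p) →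
    IsProb p n π → ((x : Fin n) → IsProb p (k x) (γ x)) →
    I (total p n k) (coprod p n π k γ)
      ≡ addₚ p (I n π) (sumₚ p n (λ x → mulₚ p (π x) (I (k x) (γ x))))

  coprod-All : ∀ (P : Zp p → Set) n π k γ → (∀ x y → P (mulₚ p (π x) (γ x y))) → ∀ y → P (coprod p n π k γ y)
  coprod-All P (suc n) π k γ P-blocks y with F.splitAt (k zero) y
  ... | inj₁ i = P-blocks zero i
  ... | inj₂ j = coprod-All P n (π ∘ suc) (k ∘ suc) (γ ∘ suc) (P-blocks ∘ suc) j

  IsProb-coprod : ∀ n π k γ → IsProb p n π → (∀ x → IsProb p (k x) (γ x)) →
                  IsProb p (total p n k) (coprod p n π k γ)
  IsProb-coprod n π k γ π-prob γ-prob = begin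
    sumₚ p (total p n k) (coprod p n π k γ)             ≡⟨ ∑ₚ.∑-coprod p n π k γ (λ z → z) ⟩
    sumₚ p n (λ x → sumₚ p (k x) (λ y → π x *ₚ γ x y))  ≡⟨ ∑ₚ.∑-cong n block-mass ⟩
    sumₚ p n π                                          ≡⟨ π-prob ⟩
    1#                                                  ∎
    where
    open ≡-Reasoning
    block-mass : ∀ x → sumₚ p (k x) (λ y → π x *ₚ γ x y) ≡ π x
    block-mass x = begin
      sumₚ p (k x) (λ y → π x *ₚ γ x y) ≡⟨ ∑ₚ.*-distribˡ-∑ (k x) (π x) (γ x) ⟨
      π x *ₚ sumₚ p (k x) (γ x)         ≡⟨ cong (π x *ₚ_) (γ-prob x) ⟩
      π x *ₚ 1#                         ≡⟨ *-identityʳ (π x) ⟩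
      π x                               ∎

  IsoInvariant-cong : ∀ {I K : Information} → (∀ n π → IsProb p n π → I n π ≡ K n π) →
                      IsoInvariant K → IsoInvariant I
  IsoInvariant-cong I≐K K-invariant m n f f-bij σ π σ-prob π-prob σ≗π∘f =
    trans (I≐K m σ σ-prob) (trans (K-invariant m n f f-bij σ π σ-prob π-prob σ≗π∘f) (sym (I≐K n π π-prob)))

  ChainRule-cong : ∀ {I K : Information} → (∀ n π → IsProb p n π → I n π ≡ K n π) →
                   ChainRule K → ChainRule I
  ChainRule-cong {I} {K} I≐K K-chain n π k γ π-prob γ-prob = begin
    I (total p n k) (coprod p n π k γ)             ≡⟨ I≐K _ _ (IsProb-coprod n π k γ π-prob γ-prob) ⟩
    K (total p n k) (coprod p n π k γ)             ≡⟨ K-chain n π k γ π-prob γ-prob ⟩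
    K n π +ₚ sumₚ p n (λ x → π x *ₚ K (k x) (γ x)) ≡⟨ cong₂ _+ₚ_ (I≐K n π π-prob)
                                                       (∑ₚ.∑-cong n (λ x → cong (π x *ₚ_) (I≐K (k x) (γ x) (γ-prob x)))) ⟨
    I n π +ₚ sumₚ p n (λ x → π x *ₚ I (k x) (γ x)) ∎
    where open ≡-Reasoning

  IsoInvariant-linear : ∀ a b {I K : Information} → IsoInvariant I → IsoInvariant K →
                        IsoInvariant (λ n π → a *ₚ I n π +ₚ b *ₚ K n π)
  IsoInvariant-linear a b I-invariant K-invariant m n f f-bij σ π σ-prob π-prob σ≗π∘f =
    cong₂ (λ i j → a *ₚ i +ₚ b *ₚ j) (I-invariant m n f f-bij σ π σ-prob π-prob σ≗π∘f)
                                       (K-invariant m n f f-bij σ π σ-prob π-prob σ≗π∘f)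

  ChainRule-linear : ∀ a b {I K : Information} → ChainRule I → ChainRule K →
                     ChainRule (λ n π → a *ₚ I n π +ₚ b *ₚ K n π)
  ChainRule-linear a b {I} {K} I-chain K-chain n π k γ π-prob γ-prob = begin
    a *ₚ I (total p n k) (coprod p n π k γ) +ₚ b *ₚ K (total p n k) (coprod p n π k γ)
      ≡⟨ cong₂ (λ i j → a *ₚ i +ₚ b *ₚ j) (I-chain n π k γ π-prob γ-prob) (K-chain n π k γ π-prob γ-prob) ⟩
    a *ₚ (I n π +ₚ ∑I) +ₚ b *ₚ (K n π +ₚ ∑K)
      ≡⟨ solve 6 (λ a b i j s t → a :* (i :+ s) :+ b :* (j :+ t) := (a :* i :+ b :* j) :+ (a :* s :+ b :* t))
                 refl a b (I n π) (K n π) ∑I ∑K ⟩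
    (a *ₚ I n π +ₚ b *ₚ K n π) +ₚ (a *ₚ ∑I +ₚ b *ₚ ∑K)
      ≡⟨ cong (a *ₚ I n π +ₚ b *ₚ K n π +ₚ_) (cong₂ _+ₚ_ (∑ₚ.*-distribˡ-∑ n a _) (∑ₚ.*-distribˡ-∑ n b _)) ⟩
    (a *ₚ I n π +ₚ b *ₚ K n π) +ₚ (sumₚ p n (λ x → a *ₚ (π x *ₚ I (k x) (γ x))) +ₚ sumₚ p n (λ x → b *ₚ (π x *ₚ K (k x) (γ x))))
      ≡⟨ cong (a *ₚ I n π +ₚ b *ₚ K n π +ₚ_) (∑ₚ.∑-distrib-+ n _ _) ⟨
    (a *ₚ I n π +ₚ b *ₚ K n π) +ₚ sumₚ p n (λ x → a *ₚ (π x *ₚ I (k x) (γ x)) +ₚ b *ₚ (π x *ₚ K (k x) (γ x)))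
      ≡⟨ cong (a *ₚ I n π +ₚ b *ₚ K n π +ₚ_) (∑ₚ.∑-cong n (λ x →
           solve 5 (λ a b c i j → a :* (c :* i) :+ b :* (c :* j) := c :* (a :* i :+ b :* j))
                   refl a b (π x) (I (k x) (γ x)) (K (k x) (γ x)))) ⟩
    (a *ₚ I n π +ₚ b *ₚ K n π) +ₚ sumₚ p n (λ x → π x *ₚ (a *ₚ I (k x) (γ x) +ₚ b *ₚ K (k x) (γ x))) ∎
    where
    open ≡-Reasoning
    ∑I = sumₚ p n (λ x → π x *ₚ I (k x) (γ x))
    ∑K = sumₚ p n (λ x → π x *ₚ K (k x) (γ x))

module PrimeField (q : ℕ) (prime : Prime (suc (suc q))) where

  p : ℕ
  p = suc (suc q)

  open Residues p public

  open CommutativeRing +-*-commutativeRing using (commutativeSemiring; semiring; +-monoid; +-rawMonoid)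
  open import Algebra.Properties.Semiring.Exp semiring public using (_^_)
  open import Algebra.Properties.CommutativeSemiring.Exp commutativeSemiring public using (^-distrib-*)
  import Algebra.Properties.CommutativeSemiring.Binomial commutativeSemiring as Binomial
  import Algebra.Properties.Monoid.Sum +-monoid as MonoidSum
  open import Algebra.Definitions.RawMonoid +-rawMonoid using () renaming (_×_ to _·_)

  ·-ι : ∀ n a → n · a ≡ ι n *ₚ a
  ·-ι zero    a = sym (*-zeroˡ a)
  ·-ι (suc n) a = trans (cong (a +ₚ_) (·-ι n a)) (sym (ι-suc-* n a))

  p∤m! : ∀ m → m ℕ.< p → ¬ (p ∣ m !)
  p∤m! zero    _   p∣1 = ℕ.<⇒≱ (s≤s (s≤s z≤n)) (∣⇒≤ p∣1)
  p∤m! (suc m) m<p p∣m! with euclidsLemma (suc m) (m !) prime p∣m!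
  ... | inj₁ p∣m = ℕ.<⇒≱ m<p (∣⇒≤ p∣m)
  ... | inj₂ p∣m! = p∤m! m (ℕ.<-trans (ℕ.n<1+n m) m<p) p∣m!

  p∣pCk : ∀ k → 0 ℕ.< k → k ℕ.< p → p ∣ p C k
  p∣pCk k 0<k k<p with euclidsLemma (p C k) (k ! ℕ.* (p ℕ.∸ k) !) prime p∣pCk*k!*[p-k]!
    where
    k≤p = ℕ.<⇒≤ k<p
    instance _ = ℕ._!*_!≢0 k (p ℕ.∸ k)
    pCk*k!*[p-k]!≡p! : (p C k) ℕ.* (k ! ℕ.* (p ℕ.∸ k) !) ≡ p !
    pCk*k!*[p-k]!≡p! = trans (cong (ℕ._* (k ! ℕ.* (p ℕ.∸ k) !)) (nCk≡n!/k![n-k]! k≤p))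
      (ℕ.m/n*n≡m (subst (_∣ p !) (ℕ.*-comm ((p ℕ.∸ k) !) (k !)) ([n∸k]!k!∣n! k≤p)))
    p∣pCk*k!*[p-k]! : p ∣ (p C k) ℕ.* (k ! ℕ.* (p ℕ.∸ k) !)
    p∣pCk*k!*[p-k]! = subst (p ∣_) (sym pCk*k!*[p-k]!≡p!) (m∣m*n (suc q !))
  ... | inj₁ p∣pCk = p∣pCk
  ... | inj₂ p∣k!*[p-k]! with euclidsLemma (k !) ((p ℕ.∸ k) !) prime p∣k!*[p-k]!
  ...   | inj₁ p∣k! = ⊥-elim (p∤m! k k<p p∣k!)
  ...   | inj₂ p∣[p-k]! = ⊥-elim (p∤m! (p ℕ.∸ k) (ℕ.∸-monoʳ-< 0<k (ℕ.<⇒≤ k<p)) p∣[p-k]!)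

  ^-zeroˡ : ∀ n → 1# ^ n ≡ 1#
  ^-zeroˡ zero    = refl
  ^-zeroˡ (suc n) = trans (cong (1# *ₚ_) (^-zeroˡ n)) (*-identityˡ 1#)

  binomialTerm₁ : Zp p → Fin (suc p) → Zp p
  binomialTerm₁ x = Binomial.binomialTerm x 1# p

  binomialTerm₁-first : ∀ x → binomialTerm₁ x zero ≡ 1#
  binomialTerm₁-first x = begin
    1# *ₚ 1# ^ p +ₚ 0#  ≡⟨ +-identityʳ _ ⟩
    1# *ₚ 1# ^ p        ≡⟨ *-identityˡ _ ⟩
    1# ^ p              ≡⟨ ^-zeroˡ p ⟩
    1#                  ∎
    where open ≡-Reasoning

  binomialTerm₁-last : ∀ x → binomialTerm₁ x (F.fromℕ p) ≡ x ^ p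
  binomialTerm₁-last x = begin
    binomialTerm₁ x (F.fromℕ p)                                ≡⟨ ·-ι (p C toℕ (F.fromℕ p)) _ ⟩
    ι (p C toℕ (F.fromℕ p)) *ₚ (x ^ toℕ (F.fromℕ p) *ₚ 1# ^ (p ℕ.∸ toℕ (F.fromℕ p)))
      ≡⟨ cong (λ k → ι (p C k) *ₚ (x ^ k *ₚ 1# ^ (p ℕ.∸ k))) (F.toℕ-fromℕ p) ⟩
    ι (p C p) *ₚ (x ^ p *ₚ 1# ^ (p ℕ.∸ p))                     ≡⟨ cong₂ (λ a b → ι a *ₚ (x ^ p *ₚ b)) (nCn≡1 p) (^-zeroˡ (p ℕ.∸ p)) ⟩
    1# *ₚ (x ^ p *ₚ 1#)                                        ≡⟨ *-identityˡ _ ⟩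
    x ^ p *ₚ 1#                                                ≡⟨ *-identityʳ _ ⟩
    x ^ p                                                      ∎
    where open ≡-Reasoning

  binomialTerm₁-inner : ∀ x (j : Fin (suc q)) → binomialTerm₁ x (F.inject₁ (suc j)) ≡ 0#
  binomialTerm₁-inner x j = begin
    binomialTerm₁ x (F.inject₁ (suc j)) ≡⟨ ·-ι (p C k) w ⟩
    ι (p C k) *ₚ w                      ≡⟨ cong (_*ₚ w) (ι-multiple (p C k) (p∣pCk k (s≤s z≤n) k<p)) ⟩
    0# *ₚ w                             ≡⟨ *-zeroˡ w ⟩
    0#                                  ∎
    where
    open ≡-Reasoning
    k = toℕ (F.inject₁ (suc j))
    w = Binomial.binomial x 1# p (F.inject₁ (suc j))
    k<p : k ℕ.< p
    k<p = subst (ℕ._< p) (sym (F.toℕ-inject₁ (suc j))) (s≤s (F.toℕ<n j))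

  -- In (x + 1)^p only the two outer binomial terms survive, since p ∣ p C k for 0 < k < p.
  frobenius-+1 : ∀ x → (x +ₚ 1#) ^ p ≡ x ^ p +ₚ 1#
  frobenius-+1 x = begin
    (x +ₚ 1#) ^ p                   ≡⟨ Binomial.theorem p x 1# ⟩
    MonoidSum.sum (binomialTerm₁ x)  ≡⟨ MonoidSum.sum-init-last (binomialTerm₁ x) ⟩
    binomialTerm₁ x zero +ₚ MonoidSum.sum (binomialTerm₁ x ∘ F.inject₁ ∘ suc) +ₚ binomialTerm₁ x (F.fromℕ p)
      ≡⟨ cong₂ (λ a b → a +ₚ b +ₚ binomialTerm₁ x (F.fromℕ p)) (binomialTerm₁-first x)
               (trans (MonoidSum.sum-cong-≗ (binomialTerm₁-inner x)) (MonoidSum.sum-replicate-zero (suc q))) ⟩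
    1# +ₚ 0# +ₚ binomialTerm₁ x (F.fromℕ p) ≡⟨ cong₂ _+ₚ_ (+-identityʳ 1#) (binomialTerm₁-last x) ⟩
    1# +ₚ x ^ p                     ≡⟨ +-comm 1# (x ^ p) ⟩
    x ^ p +ₚ 1#                     ∎
    where open ≡-Reasoning

  fermat : ∀ a → a ^ p ≡ a
  fermat = ι-elim fermat-ι
    where
    fermat-ι : ∀ n → ι n ^ p ≡ ι n
    fermat-ι zero    = *-zeroˡ (0# ^ suc q)
    fermat-ι (suc n) = begin
      ι (suc n) ^ p      ≡⟨ cong (_^ p) (trans (ι-+ 1 n) (+-comm 1# (ι n))) ⟩
      (ι n +ₚ 1#) ^ p    ≡⟨ frobenius-+1 (ι n) ⟩
      ι n ^ p +ₚ 1#      ≡⟨ cong (_+ₚ 1#) (fermat-ι n) ⟩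
      ι n +ₚ 1#          ≡⟨ trans (ι-+ 1 n) (+-comm 1# (ι n)) ⟨
      ι (suc n)          ∎
      where open ≡-Reasoning

  0#≢1# : 0# ≢ 1#
  0#≢1# 0≡1 with cong toℕ 0≡1
  ... | ()

  a*b≡0⇒a≡0∨b≡0 : ∀ a b → a *ₚ b ≡ 0# → a ≡ 0# ⊎ b ≡ 0#
  a*b≡0⇒a≡0∨b≡0 = ι-elim λ m → ι-elim λ n ιm*ιn≡0 →
    Sum.map (ι-multiple m) (ι-multiple n) (euclidsLemma m n prime (ι≡0⇒∣ (m ℕ.* n) (trans (ι-* m n) ιm*ιn≡0)))

  a-b≡0⇒a≡b : ∀ a b → a -ₚ b ≡ 0# → a ≡ b
  a-b≡0⇒a≡b a b a-b≡0 = begin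
    a              ≡⟨ solve 2 (λ a b → a := (a :- b) :+ b) refl a b ⟩
    (a -ₚ b) +ₚ b  ≡⟨ cong (_+ₚ b) a-b≡0 ⟩
    0# +ₚ b        ≡⟨ +-identityˡ b ⟩
    b              ∎
    where open ≡-Reasoning

  *-cancelˡ-≡ : ∀ a {b c} → a ≢ 0# → a *ₚ b ≡ a *ₚ c → b ≡ c
  *-cancelˡ-≡ a {b} {c} a≢0 ab≡ac = Sum.[ ⊥-elim ∘ a≢0 , a-b≡0⇒a≡b b c ] (a*b≡0⇒a≡0∨b≡0 a (b -ₚ c) a[b-c]≡0)
    where
    a[b-c]≡0 : a *ₚ (b -ₚ c) ≡ 0#
    a[b-c]≡0 = trans (solve 3 (λ a b c → a :* (b :- c) := a :* b :- a :* c) refl a b c)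
      (trans (cong (_-ₚ a *ₚ c) ab≡ac) (solve 1 (λ x → x :- x := con (+ 0)) refl (a *ₚ c)))

  _⁻¹ : Zp p → Zp p
  a ⁻¹ = a ^ q

  -- By Fermat, a * (a * a ^ (p - 2)) = a ^ p = a.
  *-inverseʳ : ∀ a → a ≢ 0# → a *ₚ a ⁻¹ ≡ 1#
  *-inverseʳ a a≢0 = *-cancelˡ-≡ a a≢0 (trans (fermat a) (sym (*-identityʳ a)))

  lift : Zp p → ℤ
  lift a = + toℕ a

  φ-lift : ∀ a → φ (lift a) ≡ a
  φ-lift a = trans (φ-pos (toℕ a)) (ι-toℕ a)

  φ-^ : ∀ x n → φ (x ℤ.^ n) ≡ φ x ^ n
  φ-^ x zero    = refl
  φ-^ x (suc n) = trans (φ-* x _) (cong (φ x *ₚ_) (φ-^ x n))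

  φ-lift-^p : ∀ a → φ (lift a ℤ.^ p) ≡ a
  φ-lift-^p a = trans (φ-^ (lift a) p) (trans (cong (_^ p) (φ-lift a)) (fermat a))

  φ-∑ : ∀ n f → φ (sumℤ p n f) ≡ sumₚ p n (φ ∘ f)
  φ-∑ zero    f = refl
  φ-∑ (suc n) f = trans (φ-+ (f zero) _) (cong (φ (f zero) +ₚ_) (φ-∑ n (f ∘ suc)))

  φ≡0⇒p∣ : ∀ z → φ z ≡ 0# → z ≡ (z /ℕ p) ℤ.* + p
  φ≡0⇒p∣ z φz≡0 = trans (a≡a%ℕn+[a/ℕn]*n z p)
    (trans (cong (λ r → + r ℤ.+ (z /ℕ p) ℤ.* + p) z%p≡0) (ℤ.+-identityˡ _))
    where
    z%p≡0 : z %ℕ p ≡ 0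
    z%p≡0 = trans (sym (ℕ.m<n⇒m%n≡m (n%ℕd<d z p))) (trans (sym (toℕ-ι (z %ℕ p))) (trans (cong toℕ φz≡0) toℕ-0#))

  φ-geometric : ∀ n x y → φ x ≡ φ y → φ (geometric (suc n) x y) ≡ ι (suc n) *ₚ φ y ^ n
  φ-geometric zero x y _ = begin
    φ (+ 1 ℤ.+ y ℤ.* + 0)  ≡⟨ φ-+ (+ 1) (y ℤ.* + 0) ⟩
    1# +ₚ φ (y ℤ.* + 0)    ≡⟨ cong (1# +ₚ_) (φ-* y (+ 0)) ⟩
    1# +ₚ φ y *ₚ 0#        ≡⟨ solve 1 (λ a → con (+ 1) :+ a :* con (+ 0) := con (+ 1) :* con (+ 1)) refl (φ y) ⟩
    1# *ₚ 1#               ∎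
    where open ≡-Reasoning
  φ-geometric (suc n) x y x≡y = begin
    φ (x ℤ.^ suc n ℤ.+ y ℤ.* geometric (suc n) x y)        ≡⟨ φ-+ (x ℤ.^ suc n) _ ⟩
    φ (x ℤ.^ suc n) +ₚ φ (y ℤ.* geometric (suc n) x y)     ≡⟨ cong₂ _+ₚ_ (φ-^ x (suc n)) (φ-* y _) ⟩
    φ x ^ suc n +ₚ φ y *ₚ φ (geometric (suc n) x y)        ≡⟨ cong₂ (λ a b → a ^ suc n +ₚ φ y *ₚ b) x≡y (φ-geometric n x y x≡y) ⟩
    φ y *ₚ φ y ^ n +ₚ φ y *ₚ (ι (suc n) *ₚ φ y ^ n)        ≡⟨ solve 3 (λ u v m → u :* v :+ u :* (m :* v) := u :* v :+ m :* (u :* v))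
                                                                refl (φ y) (φ y ^ n) (ι (suc n)) ⟩
    φ y ^ suc n +ₚ ι (suc n) *ₚ φ y ^ suc n                ≡⟨ ι-suc-* (suc n) (φ y ^ suc n) ⟨
    ι (suc (suc n)) *ₚ φ y ^ suc n                         ∎
    where open ≡-Reasoning

  -- x ≡ y (mod p) gives x ^ p ≡ y ^ p (mod p²): both factors of
  -- x ^ p - y ^ p = (x - y) (x ^ (p-1) + … + y ^ (p-1)) are divisible by p.
  ^p-congruence : ∀ x y → φ x ≡ φ y → Σ ℤ (λ w → x ℤ.^ p ≡ y ℤ.^ p ℤ.+ w ℤ.* (+ p ℤ.* + p))
  ^p-congruence x y x≡y = t ℤ.* g , (begin
    x ℤ.^ p                                             ≡⟨ add-sub (x ℤ.^ p) (y ℤ.^ p) ⟩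
    y ℤ.^ p ℤ.+ (x ℤ.^ p ℤ.- y ℤ.^ p)                   ≡⟨ cong (ℤ._+_ (y ℤ.^ p)) (x^n-y^n≡[x-y]*geometric p x y) ⟩
    y ℤ.^ p ℤ.+ (x ℤ.- y) ℤ.* geometric p x y           ≡⟨ cong₂ (λ a b → y ℤ.^ p ℤ.+ a ℤ.* b) x-y≡tp geometric≡gp ⟩
    y ℤ.^ p ℤ.+ (t ℤ.* + p) ℤ.* (g ℤ.* + p)             ≡⟨ regroup (y ℤ.^ p) t g (+ p) ⟩
    y ℤ.^ p ℤ.+ (t ℤ.* g) ℤ.* (+ p ℤ.* + p)             ∎)
    where
    open ≡-Reasoning
    t = (x ℤ.- y) /ℕ p
    g = geometric p x y /ℕ p
    add-sub : ∀ a b → a ≡ b ℤ.+ (a ℤ.- b)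
    add-sub = solve-∀
    regroup : ∀ a t g p → a ℤ.+ (t ℤ.* p) ℤ.* (g ℤ.* p) ≡ a ℤ.+ (t ℤ.* g) ℤ.* (p ℤ.* p)
    regroup = solve-∀
    x-y≡tp : x ℤ.- y ≡ t ℤ.* + p
    x-y≡tp = φ≡0⇒p∣ (x ℤ.- y) (begin
      φ (x ℤ.- y)       ≡⟨ φ-+ x (ℤ.- y) ⟩
      φ x +ₚ φ (ℤ.- y)  ≡⟨ cong₂ _+ₚ_ x≡y (φ-neg y) ⟩
      φ y -ₚ φ y        ≡⟨ -‿inverseʳ (φ y) ⟩
      0#                ∎)
    geometric≡gp : geometric p x y ≡ g ℤ.* + p
    geometric≡gp = φ≡0⇒p∣ (geometric p x y) (begin
      φ (geometric p x y)      ≡⟨ φ-geometric (suc q) x y x≡y ⟩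
      ι p *ₚ φ y ^ suc q       ≡⟨ cong (_*ₚ φ y ^ suc q) ι-p ⟩
      0# *ₚ φ y ^ suc q        ≡⟨ *-zeroˡ (φ y ^ suc q) ⟩
      0#                       ∎)

module EntropyProperties (q : ℕ) (prime : Prime (suc (suc q))) where

  open PrimeField q prime public

  powerSum : (n : ℕ) → (Fin n → Zp p) → ℤ
  powerSum n π = sumℤ p n (λ x → lift (π x) ℤ.^ p)

  -- H p n π unfolds to φ (Hℤ n π).
  Hℤ : (n : ℕ) → (Fin n → Zp p) → ℤ
  Hℤ n π = (+ 1 ℤ.- powerSum n π) /ℕ p

  1-powerSum≡Hℤ*p : ∀ n π → IsProb p n π → + 1 ℤ.- powerSum n π ≡ Hℤ n π ℤ.* + p
  1-powerSum≡Hℤ*p n π π-prob = φ≡0⇒p∣ _ (begin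
    φ (+ 1 ℤ.- powerSum n π)                        ≡⟨ φ-+ (+ 1) (ℤ.- powerSum n π) ⟩
    φ (+ 1) +ₚ φ (ℤ.- powerSum n π)                 ≡⟨ cong (φ (+ 1) +ₚ_) (φ-neg (powerSum n π)) ⟩
    φ (+ 1) -ₚ φ (powerSum n π)                     ≡⟨ cong (_-ₚ_ (φ (+ 1))) (φ-∑ n _) ⟩
    φ (+ 1) -ₚ sumₚ p n (λ x → φ (lift (π x) ℤ.^ p)) ≡⟨ cong₂ _-ₚ_ (φ-pos 1) (trans (∑ₚ.∑-cong n (φ-lift-^p ∘ π)) π-prob) ⟩
    1# -ₚ 1#                                         ≡⟨ -‿inverseʳ 1# ⟩
    0#                                               ∎)
    where open ≡-Reasoning

  H-reindex : ∀ m n (f : Fin m → Fin n) → Bijective _≡_ _≡_ f → (σ : Fin m → Zp p) (π : Fin n → Zp p) →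
              σ ≗ π ∘ f → H p m σ ≡ H p n π
  H-reindex m n f f-bij σ π σ≗π∘f = cong (λ s → φ ((+ 1 ℤ.- s) /ℕ p))
    (trans (∑ℤ.∑-cong m (λ y → cong (λ a → lift a ℤ.^ p) (σ≗π∘f y)))
           (∑ℤ.∑-reindex m n f f-bij (λ x → lift (π x) ℤ.^ p)))

  -- W x collects the p²-error terms of block x; they vanish after division by p and reduction mod p.
  module EntropyChain (n : ℕ) (π : Fin n → Zp p) (k : Fin n → ℕ) (γ : (x : Fin n) → Fin (k x) → Zp p)
                      (π-prob : IsProb p n π) (γ-prob : ∀ x → IsProb p (k x) (γ x)) where

    open ≡-Reasoning

    p² : ℤ
    p² = + p ℤ.* + p

    a : Fin n → ℤ
    a x = lift (π x)

    product-congruence : ∀ x y → Σ ℤ (λ w → lift (π x *ₚ γ x y) ℤ.^ p ≡ (a x ℤ.* lift (γ x y)) ℤ.^ p ℤ.+ w ℤ.* p²)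
    product-congruence x y = ^p-congruence (lift (π x *ₚ γ x y)) (a x ℤ.* lift (γ x y))
      (trans (φ-lift _) (sym (trans (φ-* (a x) (lift (γ x y))) (cong₂ _*ₚ_ (φ-lift (π x)) (φ-lift (γ x y))))))

    W : Fin n → ℤ
    W x = sumℤ p (k x) (λ y → proj₁ (product-congruence x y))

    block-powerSum : ∀ x → sumℤ p (k x) (λ y → lift (π x *ₚ γ x y) ℤ.^ p) ≡ a x ℤ.^ p ℤ.* powerSum (k x) (γ x) ℤ.+ W x ℤ.* p²
    block-powerSum x = begin
      sumℤ p (k x) (λ y → lift (π x *ₚ γ x y) ℤ.^ p)
        ≡⟨ ∑ℤ.∑-cong (k x) (λ y → trans (proj₂ (product-congruence x y))
                                        (cong (ℤ._+ proj₁ (product-congruence x y) ℤ.* p²) (ℤ-^-distrib-* (a x) (lift (γ x y)) p))) ⟩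
      sumℤ p (k x) (λ y → a x ℤ.^ p ℤ.* lift (γ x y) ℤ.^ p ℤ.+ proj₁ (product-congruence x y) ℤ.* p²)
        ≡⟨ ∑ℤ.∑-distrib-+ (k x) _ _ ⟩
      sumℤ p (k x) (λ y → a x ℤ.^ p ℤ.* lift (γ x y) ℤ.^ p) ℤ.+ sumℤ p (k x) (λ y → proj₁ (product-congruence x y) ℤ.* p²)
        ≡⟨ cong₂ ℤ._+_ (∑ℤ.*-distribˡ-∑ (k x) (a x ℤ.^ p) _) (∑ℤ.*-distribʳ-∑ (k x) p² _) ⟨
      a x ℤ.^ p ℤ.* powerSum (k x) (γ x) ℤ.+ W x ℤ.* p² ∎

    A : ℤ
    A = sumℤ p n (λ x → a x ℤ.^ p ℤ.* Hℤ (k x) (γ x))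

    Wtotal : ℤ
    Wtotal = sumℤ p n W

    block-powerSum-Hℤ : ∀ x → sumℤ p (k x) (λ y → lift (π x *ₚ γ x y) ℤ.^ p)
                            ≡ a x ℤ.^ p ℤ.+ (W x ℤ.* + p ℤ.- a x ℤ.^ p ℤ.* Hℤ (k x) (γ x)) ℤ.* + p
    block-powerSum-Hℤ x = begin
      sumℤ p (k x) (λ y → lift (π x *ₚ γ x y) ℤ.^ p)                 ≡⟨ block-powerSum x ⟩
      a x ℤ.^ p ℤ.* powerSum (k x) (γ x) ℤ.+ W x ℤ.* p²              ≡⟨ cong (λ s → a x ℤ.^ p ℤ.* s ℤ.+ W x ℤ.* p²) powerSum≡ ⟩
      a x ℤ.^ p ℤ.* (+ 1 ℤ.- Hℤ (k x) (γ x) ℤ.* + p) ℤ.+ W x ℤ.* p² ≡⟨ regroup (a x ℤ.^ p) (Hℤ (k x) (γ x)) (W x) (+ p) ⟩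
      a x ℤ.^ p ℤ.+ (W x ℤ.* + p ℤ.- a x ℤ.^ p ℤ.* Hℤ (k x) (γ x)) ℤ.* + p ∎
      where
      regroup : ∀ A h w p → A ℤ.* (+ 1 ℤ.- h ℤ.* p) ℤ.+ w ℤ.* (p ℤ.* p) ≡ A ℤ.+ (w ℤ.* p ℤ.- A ℤ.* h) ℤ.* p
      regroup = solve-∀
      powerSum≡ : powerSum (k x) (γ x) ≡ + 1 ℤ.- Hℤ (k x) (γ x) ℤ.* + p
      powerSum≡ = trans (sub-sub (powerSum (k x) (γ x))) (cong (ℤ._-_ (+ 1)) (1-powerSum≡Hℤ*p (k x) (γ x) (γ-prob x)))
        where
        sub-sub : ∀ s → s ≡ + 1 ℤ.- (+ 1 ℤ.- s)
        sub-sub = solve-∀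

    powerSum-coprod : powerSum (total p n k) (coprod p n π k γ) ≡ powerSum n π ℤ.+ (Wtotal ℤ.* + p ℤ.- A) ℤ.* + p
    powerSum-coprod = begin
      powerSum (total p n k) (coprod p n π k γ)
        ≡⟨ ∑ℤ.∑-coprod p n π k γ (λ z → lift z ℤ.^ p) ⟩
      sumℤ p n (λ x → sumℤ p (k x) (λ y → lift (π x *ₚ γ x y) ℤ.^ p))
        ≡⟨ ∑ℤ.∑-cong n block-powerSum-Hℤ ⟩
      sumℤ p n (λ x → a x ℤ.^ p ℤ.+ (W x ℤ.* + p ℤ.- a x ℤ.^ p ℤ.* Hℤ (k x) (γ x)) ℤ.* + p)
        ≡⟨ ∑ℤ.∑-distrib-+ n _ _ ⟩
      powerSum n π ℤ.+ sumℤ p n (λ x → (W x ℤ.* + p ℤ.- a x ℤ.^ p ℤ.* Hℤ (k x) (γ x)) ℤ.* + p)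
        ≡⟨ cong (ℤ._+_ (powerSum n π)) (∑ℤ.*-distribʳ-∑ n (+ p) _) ⟨
      powerSum n π ℤ.+ sumℤ p n (λ x → W x ℤ.* + p ℤ.- a x ℤ.^ p ℤ.* Hℤ (k x) (γ x)) ℤ.* + p
        ≡⟨ cong (λ s → powerSum n π ℤ.+ s ℤ.* + p) ∑-difference ⟩
      powerSum n π ℤ.+ (Wtotal ℤ.* + p ℤ.- A) ℤ.* + p ∎
      where
      ∑-difference : sumℤ p n (λ x → W x ℤ.* + p ℤ.- a x ℤ.^ p ℤ.* Hℤ (k x) (γ x)) ≡ Wtotal ℤ.* + p ℤ.- A
      ∑-difference = trans (∑ℤ-sub n _ _) (cong (ℤ._- A) (sym (∑ℤ.*-distribʳ-∑ n (+ p) W)))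

    Hℤ-coprod : Hℤ (total p n k) (coprod p n π k γ) ≡ Hℤ n π ℤ.+ A ℤ.- Wtotal ℤ.* + p
    Hℤ-coprod = ℤ.*-cancelʳ-≡ _ _ (+ p) (begin
      Hℤ (total p n k) (coprod p n π k γ) ℤ.* + p
        ≡⟨ 1-powerSum≡Hℤ*p (total p n k) (coprod p n π k γ) (IsProb-coprod p n π k γ π-prob γ-prob) ⟨
      + 1 ℤ.- powerSum (total p n k) (coprod p n π k γ) ≡⟨ cong (ℤ._-_ (+ 1)) powerSum-coprod ⟩
      + 1 ℤ.- (powerSum n π ℤ.+ (Wtotal ℤ.* + p ℤ.- A) ℤ.* + p)
        ≡⟨ regroup (+ 1) (powerSum n π) A Wtotal (+ p) ⟩
      (+ 1 ℤ.- powerSum n π) ℤ.+ (A ℤ.- Wtotal ℤ.* + p) ℤ.* + p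
        ≡⟨ cong (ℤ._+ (A ℤ.- Wtotal ℤ.* + p) ℤ.* + p) (1-powerSum≡Hℤ*p n π π-prob) ⟩
      Hℤ n π ℤ.* + p ℤ.+ (A ℤ.- Wtotal ℤ.* + p) ℤ.* + p  ≡⟨ factor (Hℤ n π) A Wtotal (+ p) ⟩
      (Hℤ n π ℤ.+ A ℤ.- Wtotal ℤ.* + p) ℤ.* + p          ∎)
      where
      regroup : ∀ o s A w p → o ℤ.- (s ℤ.+ (w ℤ.* p ℤ.- A) ℤ.* p) ≡ (o ℤ.- s) ℤ.+ (A ℤ.- w ℤ.* p) ℤ.* p
      regroup = solve-∀
      factor : ∀ h A w p → h ℤ.* p ℤ.+ (A ℤ.- w ℤ.* p) ℤ.* p ≡ (h ℤ.+ A ℤ.- w ℤ.* p) ℤ.* p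
      factor = solve-∀

    φ-A : φ A ≡ sumₚ p n (λ x → π x *ₚ H p (k x) (γ x))
    φ-A = trans (φ-∑ n _) (∑ₚ.∑-cong n (λ x →
      trans (φ-* (a x ℤ.^ p) (Hℤ (k x) (γ x))) (cong (_*ₚ H p (k x) (γ x)) (φ-lift-^p (π x)))))

    H-chain : H p (total p n k) (coprod p n π k γ) ≡ H p n π +ₚ sumₚ p n (λ x → π x *ₚ H p (k x) (γ x))
    H-chain = begin
      φ (Hℤ (total p n k) (coprod p n π k γ))             ≡⟨ cong φ Hℤ-coprod ⟩
      φ (Hℤ n π ℤ.+ A ℤ.- Wtotal ℤ.* + p)                ≡⟨ φ-+ (Hℤ n π ℤ.+ A) (ℤ.- (Wtotal ℤ.* + p)) ⟩
      φ (Hℤ n π ℤ.+ A) +ₚ φ (ℤ.- (Wtotal ℤ.* + p))       ≡⟨ cong₂ _+ₚ_ (φ-+ (Hℤ n π) A)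
                                                              (trans (φ-neg (Wtotal ℤ.* + p)) (cong (λ t → -ₚ t) (φ-* Wtotal (+ p)))) ⟩
      φ (Hℤ n π) +ₚ φ A +ₚ (-ₚ (φ Wtotal *ₚ φ (+ p)))    ≡⟨ cong (λ t → φ (Hℤ n π) +ₚ φ A +ₚ (-ₚ (φ Wtotal *ₚ t)))
                                                              (trans (φ-pos p) ι-p) ⟩
      φ (Hℤ n π) +ₚ φ A +ₚ (-ₚ (φ Wtotal *ₚ 0#))         ≡⟨ solve 3 (λ h a w → h :+ a :+ (:- (w :* con (+ 0))) := h :+ a) refl (φ (Hℤ n π)) (φ A) (φ Wtotal) ⟩
      φ (Hℤ n π) +ₚ φ A                                  ≡⟨ cong (φ (Hℤ n π) +ₚ_) φ-A ⟩
      H p n π +ₚ sumₚ p n (λ x → π x *ₚ H p (k x) (γ x)) ∎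

  H-isoInvariant : IsoInvariant p (H p)
  H-isoInvariant m n f f-bij σ π _ _ = H-reindex m n f f-bij σ π

  H-chainRule : ChainRule p (H p)
  H-chainRule n π k γ π-prob γ-prob = EntropyChain.H-chain n π k γ π-prob γ-prob

  H-ones : H p (suc p) (λ _ → 1#) ≡ -ₚ 1#
  H-ones = trans (cong φ Hℤ≡-1) (φ-neg (+ 1))
    where
    open ≡-Reasoning
    shift : ∀ b → + 1 ℤ.- (+ 1 ℤ.+ b) ≡ ℤ.- + 1 ℤ.* b
    shift = solve-∀
    Hℤ≡-1 : Hℤ (suc p) (λ _ → 1#) ≡ ℤ.- + 1
    Hℤ≡-1 = ℤ.*-cancelʳ-≡ _ _ (+ p) (begin
      Hℤ (suc p) (λ _ → 1#) ℤ.* + p    ≡⟨ 1-powerSum≡Hℤ*p (suc p) (λ _ → 1#) (IsProb-ones (suc p) ι[1+p]≡1) ⟨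
      + 1 ℤ.- powerSum (suc p) (λ _ → 1#) ≡⟨ cong (ℤ._-_ (+ 1)) (trans (∑ℤ.∑-cong (suc p) (λ _ → ℤ.^-zeroˡ p)) (sumℤ-ones (suc p))) ⟩
      + 1 ℤ.- + suc p                  ≡⟨ cong (ℤ._-_ (+ 1)) (ℤ.pos-+ 1 p) ⟩
      + 1 ℤ.- (+ 1 ℤ.+ + p)            ≡⟨ shift (+ p) ⟩
      ℤ.- + 1 ℤ.* + p                  ∎)

module Uniqueness (q : ℕ) (prime : Prime (suc (suc q))) where

  open EntropyProperties q prime
  open import Algebra.Properties.Group (CommutativeRing.+-group +-*-commutativeRing) using (identityʳ-unique)

  ones : (n : ℕ) → Fin n → Zp p
  ones n _ = 1#

  IsProb-point : IsProb p 1 (ones 1)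
  IsProb-point = +-identityʳ 1#

  [0,1] : Fin 2 → Zp p
  [0,1] zero    = 0#
  [0,1] (suc _) = 1#

  IsProb-[0,1] : IsProb p 2 [0,1]
  IsProb-[0,1] = trans (+-identityˡ _) (+-identityʳ 1#)

  [0,0,1] : Fin 3 → Zp p
  [0,0,1] zero          = 0#
  [0,0,1] (suc zero)    = 0#
  [0,0,1] (suc (suc _)) = 1#

  IsProb-[0,0,1] : IsProb p 3 [0,0,1]
  IsProb-[0,0,1] = trans (+-identityˡ _) (trans (+-identityˡ _) (+-identityʳ 1#))

  total-ones : ∀ n → total p n (λ _ → 1) ≡ n
  total-ones zero    = refl
  total-ones (suc n) = cong suc (total-ones n)

  ι[1+mp]≡1 : ∀ m → ι (suc (m ℕ.* p)) ≡ 1#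
  ι[1+mp]≡1 m = begin
    ι (1 ℕ.+ m ℕ.* p)     ≡⟨ ι-+ 1 (m ℕ.* p) ⟩
    1# +ₚ ι (m ℕ.* p)     ≡⟨ cong (1# +ₚ_) (ι-multiple (m ℕ.* p) (divides m refl)) ⟩
    1# +ₚ 0#              ≡⟨ +-identityʳ 1# ⟩
    1#                    ∎
    where open ≡-Reasoning

  uniform : (A : ℕ) → Fin A → Zp p
  uniform A _ = ι A ⁻¹

  IsProb-uniform : ∀ A → ι A ≢ 0# → IsProb p A (uniform A)
  IsProb-uniform A ιA≢0 = trans (sumₚ-const A (ι A ⁻¹)) (*-inverseʳ (ι A) ιA≢0)

  ι-*-≢0 : ∀ A B → ι A ≢ 0# → ι B ≢ 0# → ι (A ℕ.* B) ≢ 0#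
  ι-*-≢0 A B ιA≢0 ιB≢0 ιAB≡0 = Sum.[ ιA≢0 , ιB≢0 ] (a*b≡0⇒a≡0∨b≡0 (ι A) (ι B) (trans (sym (ι-* A B)) ιAB≡0))

  ι-^-≢0 : ∀ A n → ι A ≢ 0# → ι (A ℕ.^ n) ≢ 0#
  ι-^-≢0 A zero    _    = 0#≢1# ∘ sym
  ι-^-≢0 A (suc n) ιA≢0 = ι-*-≢0 A (A ℕ.^ n) ιA≢0 (ι-^-≢0 A n ιA≢0)

  -- A point of mass a ≠ 0 is refined into toℕ a points of mass a⁻¹, so every refined mass is 0 or 1.
  block-size : (a : Zp p) → Dec (a ≡ 0#) → ℕ
  block-size _ (yes _) = 1
  block-size a (no _)  = toℕ a

  block : (a : Zp p) (d : Dec (a ≡ 0#)) → Fin (block-size a d) → Zp p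
  block _ (yes _) = ones 1
  block a (no _)  = uniform (toℕ a)

  ι-toℕ-≢0 : ∀ a → a ≢ 0# → ι (toℕ a) ≢ 0#
  ι-toℕ-≢0 a a≢0 = a≢0 ∘ trans (sym (ι-toℕ a))

  IsProb-block : ∀ a d → IsProb p (block-size a d) (block a d)
  IsProb-block _ (yes _)   = IsProb-point
  IsProb-block a (no a≢0) = IsProb-uniform (toℕ a) (ι-toℕ-≢0 a a≢0)

  block-zero-one : ∀ a d y → a *ₚ block a d y ≡ 0# ⊎ a *ₚ block a d y ≡ 1#
  block-zero-one a (yes a≡0) _ = inj₁ (trans (cong (_*ₚ 1#) a≡0) (*-zeroˡ 1#))
  block-zero-one a (no a≢0)  _ = inj₂ (trans (cong (λ b → a *ₚ b ⁻¹) (ι-toℕ a)) (*-inverseʳ a a≢0))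

  module _ (J : Information p) (J-invariant : IsoInvariant p J) (J-chain : ChainRule p J)
           (J-ones : J (suc p) (ones (suc p)) ≡ 0#) where

    J-reindex : ∀ m n (f : Fin m → Fin n) → Bijective _≡_ _≡_ f → (σ : Fin m → Zp p) (π : Fin n → Zp p) →
                IsProb p n π → σ ≗ π ∘ f → J m σ ≡ J n π
    J-reindex m n f f-bij σ π π-prob σ≗π∘f = J-invariant m n f f-bij σ π σ-prob π-prob σ≗π∘f
      where
      σ-prob : IsProb p m σ
      σ-prob = trans (∑ₚ.∑-cong m σ≗π∘f) (trans (∑ₚ.∑-reindex m n f f-bij π) π-prob)

    J-cong : ∀ n (σ π : Fin n → Zp p) → IsProb p n π → σ ≗ π → J n σ ≡ J n π
    J-cong n = J-reindex n n id (Identity.bijective _≡_)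

    J-chain-cast : ∀ N n π k γ (τ : Fin N → Zp p) → IsProb p n π → (∀ x → IsProb p (k x) (γ x)) →
                   (eq : total p n k ≡ N) → coprod p n π k γ ≗ τ ∘ F.cast eq →
                   J N τ ≡ J n π +ₚ sumₚ p n (λ x → π x *ₚ J (k x) (γ x))
    J-chain-cast N n π k γ τ π-prob γ-prob eq coprod≗τ = begin
      J N τ                                                ≡⟨ J-reindex _ N (F.cast eq) (cast-bijective eq) _ τ τ-prob coprod≗τ ⟨
      J (total p n k) (coprod p n π k γ)                   ≡⟨ J-chain n π k γ π-prob γ-prob ⟩
      J n π +ₚ sumₚ p n (λ x → π x *ₚ J (k x) (γ x))       ∎
      where
      open ≡-Reasoning
      τ-prob : IsProb p N τ
      τ-prob = trans (sym (∑ₚ.∑-reindex _ N (F.cast eq) (cast-bijective eq) τ))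
                     (trans (sym (∑ₚ.∑-cong _ coprod≗τ)) (IsProb-coprod p n π k γ π-prob γ-prob))

    J-point : J 1 (ones 1) ≡ 0#
    J-point = begin
      J 1 (ones 1)                 ≡⟨ trans (+-identityʳ _) (*-identityˡ _) ⟨
      1# *ₚ J 1 (ones 1) +ₚ 0#     ≡⟨ identityʳ-unique _ _ refine ⟩
      0#                           ∎
      where
      open ≡-Reasoning
      refine : J 1 (ones 1) +ₚ (1# *ₚ J 1 (ones 1) +ₚ 0#) ≡ J 1 (ones 1)
      refine = trans (sym (J-chain 1 (ones 1) (λ _ → 1) (λ _ → ones 1) IsProb-point (λ _ → IsProb-point)))
                     (J-cong 1 _ (ones 1) IsProb-point (λ { zero → *-identityˡ 1# }))

    J-[0,0,1]-split-second : J 3 [0,0,1] ≡ J 2 [0,1] +ₚ J 2 [0,1]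
    J-[0,0,1]-split-second = begin
      J 3 [0,0,1]
        ≡⟨ J-cong 3 _ [0,0,1] IsProb-[0,0,1] (λ { zero → *-zeroˡ 1#; (suc zero) → *-identityˡ 0#; (suc (suc zero)) → *-identityˡ 1# }) ⟨
      J 3 (coprod p 2 [0,1] k γ)
        ≡⟨ J-chain 2 [0,1] k γ IsProb-[0,1] (λ { zero → IsProb-point; (suc zero) → IsProb-[0,1] }) ⟩
      J 2 [0,1] +ₚ (0# *ₚ J 1 (ones 1) +ₚ (1# *ₚ J 2 [0,1] +ₚ 0#))
        ≡⟨ cong (J 2 [0,1] +ₚ_) (solve 2 (λ a b → con (+ 0) :* a :+ (con (+ 1) :* b :+ con (+ 0)) := b) refl (J 1 (ones 1)) (J 2 [0,1])) ⟩
      J 2 [0,1] +ₚ J 2 [0,1] ∎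
      where
      open ≡-Reasoning
      k : Fin 2 → ℕ
      k zero    = 1
      k (suc _) = 2
      γ : (x : Fin 2) → Fin (k x) → Zp p
      γ zero       = ones 1
      γ (suc zero) = [0,1]

    J-[0,0,1]-split-first : J 3 [0,0,1] ≡ J 2 [0,1]
    J-[0,0,1]-split-first = begin
      J 3 [0,0,1]
        ≡⟨ J-cong 3 _ [0,0,1] IsProb-[0,0,1] (λ { zero → *-zeroˡ 0#; (suc zero) → *-zeroˡ 1#; (suc (suc zero)) → *-identityˡ 1# }) ⟨
      J 3 (coprod p 2 [0,1] k γ)
        ≡⟨ J-chain 2 [0,1] k γ IsProb-[0,1] (λ { zero → IsProb-[0,1]; (suc zero) → IsProb-point }) ⟩
      J 2 [0,1] +ₚ (0# *ₚ J 2 [0,1] +ₚ (1# *ₚ J 1 (ones 1) +ₚ 0#))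
        ≡⟨ cong (λ j → J 2 [0,1] +ₚ (0# *ₚ J 2 [0,1] +ₚ (1# *ₚ j +ₚ 0#))) J-point ⟩
      J 2 [0,1] +ₚ (0# *ₚ J 2 [0,1] +ₚ (1# *ₚ 0# +ₚ 0#))
        ≡⟨ solve 1 (λ a → a :+ (con (+ 0) :* a :+ (con (+ 1) :* con (+ 0) :+ con (+ 0))) := a) refl (J 2 [0,1]) ⟩
      J 2 [0,1] ∎
      where
      open ≡-Reasoning
      k : Fin 2 → ℕ
      k zero    = 2
      k (suc _) = 1
      γ : (x : Fin 2) → Fin (k x) → Zp p
      γ zero       = [0,1]
      γ (suc zero) = ones 1

    J-[0,1] : J 2 [0,1] ≡ 0#
    J-[0,1] = identityʳ-unique _ _ (trans (sym J-[0,0,1]-split-second) J-[0,0,1]-split-first)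

    -- Induction on m: the all-ones vector on 1 + (m+1)p points refines the one on 1 + mp points
    -- by splitting the first point into the p + 1 points of J-ones.
    J-ones-1+mp : ∀ m → J (suc (m ℕ.* p)) (ones _) ≡ 0#
    J-ones-1+mp zero    = J-point
    J-ones-1+mp (suc m) = begin
      J N (ones N)                                        ≡⟨ J-chain-cast N n (ones n) k γ (ones N) (IsProb-ones n (ι[1+mp]≡1 m)) γ-prob eq
                                                              (coprod-All p (_≡ 1#) n (ones n) k γ (λ { zero _ → *-identityˡ 1# ; (suc _) _ → *-identityˡ 1# })) ⟩
      J n (ones n) +ₚ sumₚ p n (λ x → 1# *ₚ J (k x) (γ x)) ≡⟨ cong₂ _+ₚ_ (J-ones-1+mp m) (sumₚ-zero n _ block-zero) ⟩
      0# +ₚ 0#                                            ≡⟨ +-identityʳ 0# ⟩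
      0#                                                  ∎
      where
      open ≡-Reasoning
      n = suc (m ℕ.* p)
      N = suc (suc m ℕ.* p)
      k : Fin n → ℕ
      k zero    = suc p
      k (suc _) = 1
      γ : (x : Fin n) → Fin (k x) → Zp p
      γ zero    = ones (suc p)
      γ (suc _) = ones 1
      γ-prob : ∀ x → IsProb p (k x) (γ x)
      γ-prob zero    = IsProb-ones (suc p) ι[1+p]≡1
      γ-prob (suc _) = IsProb-point
      eq : total p n k ≡ N
      eq = cong (suc p ℕ.+_) (total-ones (m ℕ.* p))
      block-zero : ∀ x → 1# *ₚ J (k x) (γ x) ≡ 0#
      block-zero zero    = trans (*-identityˡ _) J-ones
      block-zero (suc _) = trans (*-identityˡ _) J-point

    J-ones-≡1 : ∀ N → ι N ≡ 1# → J N (ones N) ≡ 0#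
    J-ones-≡1 N ιN≡1 = subst (λ t → J t (ones t) ≡ 0#) (sym N≡1+[N/p]*p) (J-ones-1+mp (N ℕ./ p))
      where
      N%p≡1 : N ℕ.% p ≡ 1
      N%p≡1 = trans (sym (toℕ-ι N)) (trans (cong toℕ ιN≡1) (toℕ-ι 1))
      N≡1+[N/p]*p : N ≡ suc (N ℕ./ p ℕ.* p)
      N≡1+[N/p]*p = trans (ℕ.m≡m%n+[m/n]*n N p) (cong (ℕ._+ N ℕ./ p ℕ.* p) N%p≡1)

    J-drop-zero : ∀ n (ν : Fin (suc n) → Zp p) → ν zero ≡ 0# → IsProb p n (ν ∘ suc) → J (suc n) ν ≡ J n (ν ∘ suc)
    J-drop-zero n ν ν0≡0 ρ-prob = begin
      J (suc n) ν                                                          ≡⟨ J-chain-cast (suc n) 2 [0,1] k γ ν IsProb-[0,1] γ-prob eq refines ⟩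
      J 2 [0,1] +ₚ (0# *ₚ J 1 (ones 1) +ₚ (1# *ₚ J n (ν ∘ suc) +ₚ 0#))   ≡⟨ cong₂ (λ a b → a +ₚ (0# *ₚ b +ₚ (1# *ₚ J n (ν ∘ suc) +ₚ 0#))) J-[0,1] J-point ⟩
      0# +ₚ (0# *ₚ 0# +ₚ (1# *ₚ J n (ν ∘ suc) +ₚ 0#))                      ≡⟨ solve 1 (λ a → con (+ 0) :+ (con (+ 0) :* con (+ 0) :+ (con (+ 1) :* a :+ con (+ 0))) := a)
                                                                                refl (J n (ν ∘ suc)) ⟩
      J n (ν ∘ suc)                                                        ∎
      where
      open ≡-Reasoning
      k : Fin 2 → ℕ
      k zero    = 1
      k (suc _) = n
      γ : (x : Fin 2) → Fin (k x) → Zp p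
      γ zero       = ones 1
      γ (suc zero) = ν ∘ suc
      γ-prob : ∀ x → IsProb p (k x) (γ x)
      γ-prob zero       = IsProb-point
      γ-prob (suc zero) = ρ-prob
      eq : total p 2 k ≡ suc n
      eq = cong suc (ℕ.+-identityʳ n)
      refines : coprod p 2 [0,1] k γ ≗ ν ∘ F.cast eq
      refines zero    = trans (*-zeroˡ 1#) (sym ν0≡0)
      refines (suc y) = trans (++-[] (λ i → 1# *ₚ ν (suc i)) _ y) (*-identityˡ _)

    J-zero-one : ∀ n (ν : Fin n → Zp p) → (∀ i → ν i ≡ 0# ⊎ ν i ≡ 1#) → IsProb p n ν → J n ν ≡ 0#
    J-zero-one zero ν _ ν-prob = ⊥-elim (0#≢1# ν-prob)
    J-zero-one (suc n) ν ν-01 ν-prob with F.any? (λ i → ν i F.≟ 0#)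
    ... | yes (j , νj≡0) = begin
      J (suc n) ν              ≡⟨ J-reindex (suc n) (suc n) (swap ⟨$⟩ʳ_) (permutation-bijective swap) ν′ ν ν-prob (λ _ → refl) ⟨
      J (suc n) ν′             ≡⟨ J-drop-zero n ν′ νj≡0 ρ-prob ⟩
      J n (ν′ ∘ suc)           ≡⟨ J-zero-one n (ν′ ∘ suc) (ν-01 ∘ (swap ⟨$⟩ʳ_) ∘ suc) ρ-prob ⟩
      0#                       ∎
      where
      open ≡-Reasoning
      swap = transpose zero j
      ν′ = ν ∘ (swap ⟨$⟩ʳ_)
      ρ-prob : IsProb p n (ν′ ∘ suc)
      ρ-prob = trans (sym (+-identityˡ _)) (trans (cong (_+ₚ sumₚ p n (ν′ ∘ suc)) (sym νj≡0))
                     (trans (∑ₚ.∑-reindex (suc n) (suc n) (swap ⟨$⟩ʳ_) (permutation-bijective swap) ν) ν-prob))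
    ... | no no-zero = trans (J-cong (suc n) ν (ones (suc n)) (IsProb-ones (suc n) ι[1+n]≡1) ν≗1) (J-ones-≡1 (suc n) ι[1+n]≡1)
      where
      ν≗1 : ∀ i → ν i ≡ 1#
      ν≗1 i = Sum.[ (λ νi≡0 → ⊥-elim (no-zero (i , νi≡0))) , id ] (ν-01 i)
      ι[1+n]≡1 : ι (suc n) ≡ 1#
      ι[1+n]≡1 = trans (sym (*-identityʳ (ι (suc n))))
        (trans (sym (sumₚ-const (suc n) 1#)) (trans (sym (∑ₚ.∑-cong (suc n) ν≗1)) ν-prob))

    J-uniform-* : ∀ A B → ι A ≢ 0# → ι B ≢ 0# → J (A ℕ.* B) (uniform (A ℕ.* B)) ≡ J A (uniform A) +ₚ J B (uniform B)
    J-uniform-* A B ιA≢0 ιB≢0 = begin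
      J (A ℕ.* B) (uniform (A ℕ.* B))
        ≡⟨ J-chain-cast (A ℕ.* B) A (uniform A) (λ _ → B) (λ _ → uniform B) (uniform (A ℕ.* B))
             (IsProb-uniform A ιA≢0) (λ _ → IsProb-uniform B ιB≢0) (total-const A B)
             (coprod-All p (_≡ ι (A ℕ.* B) ⁻¹) A (uniform A) (λ _ → B) (λ _ → uniform B) (λ _ _ → sym ⁻¹-ι-*)) ⟩
      J A (uniform A) +ₚ sumₚ p A (λ _ → ι A ⁻¹ *ₚ J B (uniform B))
        ≡⟨ cong (J A (uniform A) +ₚ_) (sumₚ-const A (ι A ⁻¹ *ₚ J B (uniform B))) ⟩
      J A (uniform A) +ₚ ι A *ₚ (ι A ⁻¹ *ₚ J B (uniform B))
        ≡⟨ cong (J A (uniform A) +ₚ_) (*-assoc (ι A) (ι A ⁻¹) (J B (uniform B))) ⟨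
      J A (uniform A) +ₚ ι A *ₚ ι A ⁻¹ *ₚ J B (uniform B)
        ≡⟨ cong (λ c → J A (uniform A) +ₚ c *ₚ J B (uniform B)) (*-inverseʳ (ι A) ιA≢0) ⟩
      J A (uniform A) +ₚ 1# *ₚ J B (uniform B)
        ≡⟨ cong (J A (uniform A) +ₚ_) (*-identityˡ (J B (uniform B))) ⟩
      J A (uniform A) +ₚ J B (uniform B) ∎
      where
      open ≡-Reasoning
      total-const : ∀ n B → total p n (λ _ → B) ≡ n ℕ.* B
      total-const zero    B = refl
      total-const (suc n) B = cong (B ℕ.+_) (total-const n B)
      ⁻¹-ι-* : ι (A ℕ.* B) ⁻¹ ≡ ι A ⁻¹ *ₚ ι B ⁻¹
      ⁻¹-ι-* = trans (cong _⁻¹ (ι-* A B)) (^-distrib-* (ι A) (ι B) q)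

    J-uniform-^ : ∀ A n → ι A ≢ 0# → J (A ℕ.^ n) (uniform (A ℕ.^ n)) ≡ ι n *ₚ J A (uniform A)
    J-uniform-^ A zero    _    = trans (J-cong 1 (uniform 1) (ones 1) IsProb-point (λ _ → ^-zeroˡ q))
                                       (trans J-point (sym (*-zeroˡ (J A (uniform A)))))
    J-uniform-^ A (suc n) ιA≢0 = begin
      J (A ℕ.* A ℕ.^ n) (uniform (A ℕ.* A ℕ.^ n))       ≡⟨ J-uniform-* A (A ℕ.^ n) ιA≢0 (ι-^-≢0 A n ιA≢0) ⟩
      J A (uniform A) +ₚ J (A ℕ.^ n) (uniform (A ℕ.^ n)) ≡⟨ cong (J A (uniform A) +ₚ_) (J-uniform-^ A n ιA≢0) ⟩
      J A (uniform A) +ₚ ι n *ₚ J A (uniform A)          ≡⟨ ι-suc-* n (J A (uniform A)) ⟨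
      ι (suc n) *ₚ J A (uniform A)                       ∎
      where open ≡-Reasoning

    -- A ^ (p - 1) ≡ 1 (mod p), so uniform (A ^ (p - 1)) is a vector of ones handled by J-ones-≡1.
    J-uniform : ∀ A → ι A ≢ 0# → J A (uniform A) ≡ 0#
    J-uniform A ιA≢0 = *-cancelˡ-≡ (ι (suc q)) ι[p-1]≢0 (begin
      ι (suc q) *ₚ J A (uniform A) ≡⟨ J-uniform-^ A (suc q) ιA≢0 ⟨
      J N (uniform N)              ≡⟨ J-cong N (uniform N) (ones N) (IsProb-ones N ιN≡1) (λ _ → trans (cong _⁻¹ ιN≡1) (^-zeroˡ q)) ⟩
      J N (ones N)                 ≡⟨ J-ones-≡1 N ιN≡1 ⟩
      0#                           ≡⟨ *-zeroʳ (ι (suc q)) ⟨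
      ι (suc q) *ₚ 0#              ∎)
      where
      open ≡-Reasoning
      N = A ℕ.^ suc q
      ιN≡1 : ι N ≡ 1#
      ιN≡1 = trans (ι-* A (A ℕ.^ q)) (trans (cong (ι A *ₚ_) (ι-^ q)) (*-inverseʳ (ι A) ιA≢0))
        where
        ι-^ : ∀ n → ι (A ℕ.^ n) ≡ ι A ^ n
        ι-^ zero    = refl
        ι-^ (suc n) = trans (ι-* A (A ℕ.^ n)) (cong (ι A *ₚ_) (ι-^ n))
      ι[p-1]≢0 : ι (suc q) ≢ 0#
      ι[p-1]≢0 ι[p-1]≡0 with trans (sym (ℕ.m<n⇒m%n≡m (ℕ.n<1+n (suc q)))) (trans (sym (toℕ-ι (suc q))) (trans (cong toℕ ι[p-1]≡0) toℕ-0#))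
      ... | ()

    J-block : ∀ a d → a *ₚ J (block-size a d) (block a d) ≡ 0#
    J-block a (yes _)   = trans (cong (a *ₚ_) J-point) (*-zeroʳ a)
    J-block a (no a≢0) = trans (cong (a *ₚ_) (J-uniform (toℕ a) (ι-toℕ-≢0 a a≢0))) (*-zeroʳ a)

    J≡0 : ∀ n π → IsProb p n π → J n π ≡ 0#
    J≡0 n π π-prob = begin
      J n π                                          ≡⟨ +-identityʳ (J n π) ⟨
      J n π +ₚ 0#                                    ≡⟨ cong (J n π +ₚ_) (sumₚ-zero n _ (λ x → J-block (π x) (d x))) ⟨
      J n π +ₚ sumₚ p n (λ x → π x *ₚ J (k x) (γ x)) ≡⟨ J-chain n π k γ π-prob (λ x → IsProb-block (π x) (d x)) ⟨
      J (total p n k) (coprod p n π k γ)             ≡⟨ J-zero-one (total p n k) _ refined-zero-one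
                                                          (IsProb-coprod p n π k γ π-prob (λ x → IsProb-block (π x) (d x))) ⟩
      0#                                             ∎
      where
      open ≡-Reasoning
      d = λ x → π x F.≟ 0#
      k = λ x → block-size (π x) (d x)
      γ = λ x → block (π x) (d x)
      refined-zero-one : ∀ y → coprod p n π k γ y ≡ 0# ⊎ coprod p n π k γ y ≡ 1#
      refined-zero-one = coprod-All p (λ z → z ≡ 0# ⊎ z ≡ 1#) n π k γ (λ x → block-zero-one (π x) (d x))

module Characterisation (q : ℕ) (prime : Prime (suc (suc q))) (I : Information (suc (suc q))) where

  open EntropyProperties q prime
  open Uniqueness q prime using (ones; J≡0)

  multiple-of-H⇒axioms : Σ (Zp p) (λ c → ∀ n π → IsProb p n π → I n π ≡ c *ₚ H p n π) →
                         IsoInvariant p I × ChainRule p I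
  multiple-of-H⇒axioms (c , I≐cH) =
    IsoInvariant-cong p {I} I≐0H+cH (IsoInvariant-linear p 0# c {H p} {H p} H-isoInvariant H-isoInvariant) ,
    ChainRule-cong p {I} I≐0H+cH (ChainRule-linear p 0# c {H p} {H p} H-chainRule H-chainRule)
    where
    I≐0H+cH : ∀ n π → IsProb p n π → I n π ≡ 0# *ₚ H p n π +ₚ c *ₚ H p n π
    I≐0H+cH n π π-prob = trans (I≐cH n π π-prob)
      (solve 2 (λ c h → c :* h := con (+ 0) :* h :+ c :* h) refl c (H p n π))

  axioms⇒multiple-of-H : IsoInvariant p I × ChainRule p I →
                         Σ (Zp p) (λ c → ∀ n π → IsProb p n π → I n π ≡ c *ₚ H p n π)
  axioms⇒multiple-of-H (I-invariant , I-chain) = c , λ n π π-prob →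
    a-b≡0⇒a≡b (I n π) (c *ₚ H p n π) (trans (sym (J≡I-cH n π)) (J≡0 J J-invariant J-chain J-ones n π π-prob))
    where
    c : Zp p
    c = -ₚ I (suc p) (ones (suc p))
    J : Information p
    J n π = 1# *ₚ I n π +ₚ (-ₚ c) *ₚ H p n π
    J-invariant : IsoInvariant p J
    J-invariant = IsoInvariant-linear p 1# (-ₚ c) {I} {H p} I-invariant H-isoInvariant
    J-chain : ChainRule p J
    J-chain = ChainRule-linear p 1# (-ₚ c) {I} {H p} I-chain H-chainRule
    J≡I-cH : ∀ n π → J n π ≡ I n π -ₚ c *ₚ H p n π
    J≡I-cH n π = solve 3 (λ c i h → con (+ 1) :* i :+ (:- c) :* h := i :- c :* h) refl c (I n π) (H p n π)
    J-ones : J (suc p) (ones (suc p)) ≡ 0#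
    J-ones = trans (cong (λ h → 1# *ₚ I (suc p) (ones (suc p)) +ₚ (-ₚ c) *ₚ h) H-ones)
      (solve 1 (λ i → con (+ 1) :* i :+ (:- (:- i)) :* (:- con (+ 1)) := con (+ 0)) refl (I (suc p) (ones (suc p))))

corollary5p7 : (p : ℕ) .{{_ : NonZero p}} → Prime p →
    (I : (n : ℕ) → (Fin n → Zp p) → Zp p) →
    ((((m n : ℕ) (f : Fin m → Fin n) → Bijective _≡_ _≡_ f →
        (σ : Fin m → Zp p) (π : Fin n → Zp p) →
        IsProb p m σ → IsProb p n π → ((y : Fin m) → σ y ≡ π (f y)) →
        I m σ ≡ I n π)
      ×
      ((n : ℕ) (π : Fin n → Zp p) (k : Fin n → ℕ)
        (γ : (x : Fin n) → Fin (k x) → Zp p) →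
        IsProb p n π → ((x : Fin n) → IsProb p (k x) (γ x)) →
        I (total p n k) (coprod p n π k γ)
          ≡ addₚ p (I n π) (sumₚ p n (λ x → mulₚ p (π x) (I (k x) (γ x))))))
     ⇔
     Σ (Zp p) (λ c → (n : ℕ) (π : Fin n → Zp p) → IsProb p n π →
        I n π ≡ mulₚ p c (H p n π)))
corollary5p7 (suc (suc q)) p-prime I = mk⇔ axioms⇒multiple-of-H multiple-of-H⇒axioms
  where open Characterisation q p-prime I
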